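{- For any non-compact simple root $\alpha\in\Delta\setminus I$, the canonical parabolic $P_\alpha$ of $s_\alpha$ is contained in the canonical parabolic $P_{\mathrm{id}}$ of the identity element of ${}^IW$.
   Context: $p$ prime, $k=\overline{\mathbb F}_p$, $\sigma$ Frobenius. $G$ connected reductive over $\mathbb F_p$, $\mu\colon\mathbb G_{m,k}\to G_k$ a cocharacter, $P=\{g:\lim_{t\to0}\mu(t)^{ -1}g\mu(t)\text{ exists}\}$ (the Hodge parabolic), $L=\mathrm{Cent}(\mu)$. $(B,T)$ a Borel pair over $\mathbb F_p$ with $\mu$ factoring through $T$, $B\subseteq P$; $W$ Weyl group, $\Phi$ roots, positive roots given by the Borel opposite to $B$, $\Delta$ simple roots with Frobenius action $\sigma$, $I$ type of $P$, $z=\sigma(w_{0,I})w_0$ with $w_0,w_{0,I}$ longest elements of $W,W_I$. ${}^IW$ = minimal length representatives of $W_I\backslash W$. For $w\in{}^IW$, let $\varphi_w(\beta)=(wz^{ -1})\cdot\sigma(\beta)$ on $\Phi$, $I_w=\bigcap_{m\ge0}\varphi_w^m(I)$, and the canonical parabolic $P_w$ is the standard parabolic containing $B$ of type $I_w$; $P_\alpha:=P_{s_\alpha}$. -}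

module Defs where

open import Data.Nat using (ℕ; zero; suc) renaming (_≤_ to _≤ℕ_)
open import Data.Integer using (ℤ; +_; 0ℤ; 1ℤ; _+_; _-_; _*_; _≤_; _<_)
open import Data.Fin using (Fin; _≟_)
open import Data.Fin.Subset using (Subset; _∈_; ⊤)
open import Data.Fin.Permutation using (Permutation′; _⟨$⟩ʳ_; _⟨$⟩ˡ_)
open import Data.List using (List; []; _∷_; _++_; map; reverse; length)
open import Data.List.Relation.Unary.All using (All)
open import Data.Product using (Σ; ∃; _×_)
open import Relation.Nullary using (¬_; yes; no)
open import Relation.Binary.PropositionalEquality using (_≡_; _≢_; _≗_)

-- Root-theoretic data of (G, B, T, σ, μ), encoded combinatorially.
-- Rank n = |Δ|; simple roots are indexed by Fin n.
-- A i j = ⟨α_i , α_j^∨⟩ (Cartan matrix), so  s_j(α_i) = α_i - A i j · α_j.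
-- Roots / elements of the root lattice are written in the basis Δ.

∑ : ∀ {n} → (Fin n → ℤ) → ℤ
∑ {zero}  f = 0ℤ
∑ {suc n} f = f Fin.zero + ∑ (λ i → f (Fin.suc i))

-- A is the Cartan matrix of a (reduced, finite) root system:
-- a generalised Cartan matrix which is symmetrisable (d_j = (α_j,α_j)/2 up to
-- scaling) with positive-definite symmetrisation (α_i,α_j) = A i j · d j.
record IsFiniteCartan {n : ℕ} (A : Fin n → Fin n → ℤ) : Set where
  field
    diag     : ∀ i → A i i ≡ + 2
    offdiag  : ∀ i j → i ≢ j → A i j ≤ 0ℤ
    d        : Fin n → ℕ
    d-pos    : ∀ i → 1 ≤ℕ d i
    symm     : ∀ i j → A i j * + d j ≡ A j i * + d i
    posdef   : ∀ (x : Fin n → ℤ) → (∃ λ k → x k ≢ 0ℤ) →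
               0ℤ < ∑ (λ i → ∑ (λ j → x i * x j * (A i j * + d j)))

-- σ acts on Δ by a permutation which is an automorphism of the Dynkin diagram
IsDiagramAut : ∀ {n} → (Fin n → Fin n → ℤ) → Permutation′ n → Set
IsDiagramAut A π = ∀ i j → A (π ⟨$⟩ʳ i) (π ⟨$⟩ʳ j) ≡ A i j

module _ {n : ℕ} (A : Fin n → Fin n → ℤ) where

  Lat : Set
  Lat = Fin n → ℤ

  e : Fin n → Lat
  e i k with k ≟ i
  ... | yes _ = 1ℤ
  ... | no  _ = 0ℤ

  sref : Fin n → Lat → Lat
  sref j v k with k ≟ j
  ... | yes _ = v k - ∑ (λ i → v i * A i j)
  ... | no  _ = v k

  -- Weyl group elements as words in simple reflections;
  -- the word  j ∷ w  represents  s_j · w ,  and  u ++ v  represents  u · v.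
  Word : Set
  Word = List (Fin n)

  act : Word → Lat → Lat
  act []      v = v
  act (j ∷ w) v = sref j (act w v)

  -- equality in W (W acts faithfully on the root lattice)
  _≈W_ : Word → Word → Set
  u ≈W v = ∀ x → act u x ≗ act v x

  HasLength : Word → ℕ → Set
  HasLength w k = (Σ Word λ u → length u ≡ k × u ≈W w)
                × (∀ u → u ≈W w → k ≤ℕ length u)

  IsLongestIn : Subset n → Word → Set
  IsLongestIn J w = All (_∈ J) w
                  × (∀ u → All (_∈ J) u → ∀ k k' → HasLength u k → HasLength w k' → k ≤ℕ k')

  -- Frobenius on W and on the root lattice: σ(s_i) = s_{π i}, σ(α_i) = α_{π i}
  σW : Permutation′ n → Word → Word
  σW π = map (π ⟨$⟩ʳ_)

  σL : Permutation′ n → Lat → Lat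
  σL π v k = v (π ⟨$⟩ˡ k)

  iter : ℕ → (Lat → Lat) → Lat → Lat
  iter zero    f x = x
  iter (suc m) f x = f (iter m f x)

  module _ (π : Permutation′ n) (I : Subset n) (w₀ w₀I : Word) where

    zW : Word
    zW = σW π w₀I ++ w₀

    -- φ_w(β) = (w z⁻¹)·σ(β)   (z⁻¹ is the reversed word, simple reflections being involutions)
    φ : Word → Lat → Lat
    φ w β = act (w ++ reverse zW) (σL π β)

    -- I_w = ⋂_{m ≥ 0} φ_w^m(I), as a subset of Δ (it is contained in I ⊆ Δ):
    -- α_i ∈ I_w  iff  for every m, α_i = φ_w^m(α_j) for some j ∈ I.
    -- I_w is the type of the canonical parabolic P_w.
    InIw : Word → Fin n → Set
    InIw w i = ∀ m → ∃ λ j → j ∈ I × iter m (φ w) (e j) ≗ e i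

-- Since φ_{s_α} = s_α ∘ φ_id and all these maps are injective, an element of
-- I_{s_α} has, for every m, a backward chain of length m of simple roots of I under φ_{s_α}; it suffices to
-- see that each step of such a chain is also a step of φ_id, i.e. that s_α fixes φ_id(α_{i′}) whenever
-- φ_{s_α}(α_{i′}) = α_i with i, i′ ∈ I.  Otherwise ⟨α_i, α^∨⟩ < 0 (as α ∉ I) and φ_id(α_{i′}) = α_i + c·α
-- with c > 0.  Now φ_id(α_{i′}) = w₀ σ(w_{0,I} α_{i′}) is a simple root: longest elements send the simple
-- roots they involve to negative roots, so pulling α_i + c·α back through w₀ and σ and applying w_{0,I}
-- would split α_{i′} into two nonzero nonnegative vectors.
--
-- The negativity of longest elements is the classical fact that w(α_j) > 0 when ℓ(w s_j) ≥ ℓ(w)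
-- (Humphreys, Reflection groups and Coxeter groups, 5.4), proved by induction on ℓ(w) with a reduction
-- to rank two; the rank-two groups are finite because the Cartan matrix is positive definite, and their
-- four types are checked by evaluation.
module Submission where

open import Defs
import Algebra.Properties.Semiring.Sum as SemiringSum
open import Data.Bool using (Bool; true; false; not)
import Data.Bool.Properties as Boolₚ
open import Data.Empty using (⊥-elim)
open import Data.Fin using (Fin; _≟_; toℕ; fromℕ<)
import Data.Fin.Properties as Finₚ
open import Data.Fin.Permutation using (Permutation′; _⟨$⟩ʳ_; _⟨$⟩ˡ_; inverseˡ; inverseʳ)
open import Data.Fin.Subset using (Subset; _∈_; _∉_; ⊤)
open import Data.Fin.Subset.Properties using (_∈?_; ∈⊤)
open import Data.Integer as ℤ using (ℤ; +_; -[1+_]; +[1+_]; 0ℤ; 1ℤ; -1ℤ; _+_; _-_; _*_; -_; _≤_; _<_; +≤+; +<+)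
import Data.Integer.Properties as ℤₚ
open import Data.Integer.Tactic.RingSolver using (solve-∀)
open import Data.List using (List; []; _∷_; _++_; _∷ʳ_; length; reverse; initLast; _∷ʳ′_)
import Data.List.Properties as Listₚ
open import Data.List.Relation.Unary.All as All using (All; []; _∷_)
import Data.List.Relation.Unary.All.Properties as Allₚ
open import Data.Nat as ℕ using (ℕ; zero; suc; z≤n; s≤s)
import Data.Nat.Properties as ℕₚ
open import Data.Nat.Induction using (<-rec)
open import Data.Product as Product using (∃; ∃₂; _×_; _,_; proj₁; proj₂)
open import Data.Sum as Sum using (_⊎_; inj₁; inj₂; [_,_]′)
open import Effect.Monad using (RawMonad)
open import Function using (_∘_)
open import Level using (0ℓ)
open import Relation.Binary.Bundles using (Setoid)
open import Relation.Binary.PropositionalEquality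
open import Relation.Nullary using (¬_; yes; no; Dec)
open import Relation.Nullary.Decidable using (True; toWitness; decidable-stable; ¬¬-excluded-middle; _×-dec_; _→-dec_)
open import Relation.Nullary.Negation using (¬¬-Monad)

open RawMonad (¬¬-Monad {a = 0ℓ})

-- Finite sums and integer arithmetic

module ℤ∑ = SemiringSum ℤₚ.+-*-semiring

∑≡sum : ∀ {m} (f : Fin m → ℤ) → ∑ f ≡ ℤ∑.sum f
∑≡sum {zero}  f = refl
∑≡sum {suc m} f = cong (λ s → f Fin.zero + s) (∑≡sum (f ∘ Fin.suc))

∑-cong : ∀ {m} {f g : Fin m → ℤ} → f ≗ g → ∑ f ≡ ∑ g
∑-cong {f = f} {g} f≗g = begin
  ∑ f        ≡⟨ ∑≡sum f ⟩
  ℤ∑.sum f   ≡⟨ ℤ∑.sum-cong-≗ {x = f} {g} f≗g ⟩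
  ℤ∑.sum g   ≡⟨ ∑≡sum g ⟨
  ∑ g        ∎
  where open ≡-Reasoning

∑-+ : ∀ {m} (f g : Fin m → ℤ) → ∑ (λ i → f i + g i) ≡ ∑ f + ∑ g
∑-+ f g = begin
  ∑ (λ i → f i + g i)        ≡⟨ ∑≡sum (λ i → f i + g i) ⟩
  ℤ∑.sum (λ i → f i + g i)   ≡⟨ ℤ∑.∑-distrib-+ f g ⟩
  ℤ∑.sum f + ℤ∑.sum g        ≡⟨ cong₂ _+_ (∑≡sum f) (∑≡sum g) ⟨
  ∑ f + ∑ g                  ∎
  where open ≡-Reasoning

∑-*ˡ : ∀ {m} c (f : Fin m → ℤ) → ∑ (λ i → c * f i) ≡ c * ∑ f
∑-*ˡ c f = begin
  ∑ (λ i → c * f i)        ≡⟨ ∑≡sum (λ i → c * f i) ⟩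
  ℤ∑.sum (λ i → c * f i)   ≡⟨ ℤ∑.*-distribˡ-sum c f ⟨
  c * ℤ∑.sum f             ≡⟨ cong (c *_) (∑≡sum f) ⟨
  c * ∑ f                  ∎
  where open ≡-Reasoning

∑-permute : ∀ {m} (f : Fin m → ℤ) (π : Permutation′ m) → ∑ f ≡ ∑ (λ i → f (π ⟨$⟩ʳ i))
∑-permute f π = begin
  ∑ f                           ≡⟨ ∑≡sum f ⟩
  ℤ∑.sum f                      ≡⟨ ℤ∑.sum-permute f π ⟩
  ℤ∑.sum (λ i → f (π ⟨$⟩ʳ i))   ≡⟨ ∑≡sum (λ i → f (π ⟨$⟩ʳ i)) ⟨
  ∑ (λ i → f (π ⟨$⟩ʳ i))        ∎
  where open ≡-Reasoning

∑-zero : ∀ {m} (f : Fin m → ℤ) → (∀ i → f i ≡ 0ℤ) → ∑ f ≡ 0ℤ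
∑-zero {zero}  f f≡0 = refl
∑-zero {suc m} f f≡0 = cong₂ _+_ (f≡0 Fin.zero) (∑-zero (f ∘ Fin.suc) (f≡0 ∘ Fin.suc))

∑-single : ∀ {m} (f : Fin m → ℤ) j → (∀ i → i ≢ j → f i ≡ 0ℤ) → ∑ f ≡ f j
∑-single f Fin.zero    f≡0 =
  trans (cong (λ s → f Fin.zero + s) (∑-zero _ (λ i → f≡0 (Fin.suc i) (λ ())))) (ℤₚ.+-identityʳ (f Fin.zero))
∑-single f (Fin.suc j) f≡0 =
  trans (cong₂ _+_ (f≡0 Fin.zero (λ ())) (∑-single (f ∘ Fin.suc) j (λ i i≢j → f≡0 (Fin.suc i) (i≢j ∘ Finₚ.suc-injective))))
        (ℤₚ.+-identityˡ (f (Fin.suc j)))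

∑-nonneg : ∀ {m} (f : Fin m → ℤ) → (∀ i → 0ℤ ≤ f i) → 0ℤ ≤ ∑ f
∑-nonneg {zero}  f f≥0 = ℤₚ.≤-refl
∑-nonneg {suc m} f f≥0 = ℤₚ.+-mono-≤ (f≥0 Fin.zero) (∑-nonneg (f ∘ Fin.suc) (f≥0 ∘ Fin.suc))

sub-*-additive : ∀ a b p q c → (a + b) - (p + q) * c ≡ (a - p * c) + (b - q * c)
sub-*-additive = solve-∀

sub-*-homogeneous : ∀ c a p r → c * a - (c * p) * r ≡ c * (a - p * r)
sub-*-homogeneous = solve-∀

0≤-* : ∀ {a b} → 0ℤ ≤ a → 0ℤ ≤ b → 0ℤ ≤ a * b
0≤-* {+ m} {+ k} _ _ = subst (0ℤ ≤_) (ℤₚ.pos-* m k) (+≤+ z≤n)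

≤0-* : ∀ {a b} → a ≤ 0ℤ → b ≤ 0ℤ → 0ℤ ≤ a * b
≤0-* {a} {b} a≤0 b≤0 = subst (0ℤ ≤_) (neg-*-neg a b) (0≤-* (ℤₚ.neg-mono-≤ a≤0) (ℤₚ.neg-mono-≤ b≤0))
  where
  neg-*-neg : ∀ a b → (- a) * (- b) ≡ a * b
  neg-*-neg = solve-∀

pos-+-* : ∀ a c b → + a + + c * + b ≡ + (a ℕ.+ c ℕ.* b)
pos-+-* a c b = cong (λ x → + a + x) (sym (ℤₚ.pos-* c b))

nonneg-sum-zero : ∀ {a b c} → 0ℤ ≤ a → 0ℤ ≤ b → 0ℤ < c → a + c * b ≡ 0ℤ → a ≡ 0ℤ × b ≡ 0ℤ
nonneg-sum-zero {+ a} {+ b} {+ c} _ _ (+<+ 0<c) sum≡0 = cong +_ (ℕₚ.m+n≡0⇒m≡0 a a+cb≡0) , cong +_ b≡0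
  where
  a+cb≡0 : a ℕ.+ c ℕ.* b ≡ 0
  a+cb≡0 = ℤₚ.+-injective (trans (sym (pos-+-* a c b)) sum≡0)
  b≡0 : b ≡ 0
  b≡0 = ℕₚ.m*n≡0⇒m≡0 b c {{ℕ.>-nonZero 0<c}} (trans (ℕₚ.*-comm b c) (ℕₚ.m+n≡0⇒n≡0 a a+cb≡0))

nonpos-sum-zero : ∀ {a b c} → a ≤ 0ℤ → b ≤ 0ℤ → 0ℤ < c → a + c * b ≡ 0ℤ → a ≡ 0ℤ × b ≡ 0ℤ
nonpos-sum-zero {a} {b} {c} a≤0 b≤0 0<c sum≡0 =
  Product.map ℤₚ.neg-injective ℤₚ.neg-injective
    (nonneg-sum-zero (ℤₚ.neg-mono-≤ a≤0) (ℤₚ.neg-mono-≤ b≤0) 0<c (trans (negate a b c) (cong -_ sum≡0)))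
  where
  negate : ∀ a b c → - a + c * - b ≡ - (a + c * b)
  negate = solve-∀

nonneg-sum-one : ∀ {a b c} → 0ℤ ≤ a → 0ℤ ≤ b → 0ℤ < c → a + c * b ≡ 1ℤ → a ≡ 0ℤ ⊎ b ≡ 0ℤ
nonneg-sum-one {+ zero}                  _ _ _         _     = inj₁ refl
nonneg-sum-one {+ suc a} {+ zero}        _ _ _         _     = inj₂ refl
nonneg-sum-one {+ suc a} {+ suc b} {+ c} _ _ (+<+ 0<c) sum≡1 =
  ⊥-elim (ℕ.≢-nonZero⁻¹ c {{ℕ.>-nonZero 0<c}} (ℕₚ.m*n≡0⇒m≡0 c (suc b) (ℕₚ.m+n≡0⇒n≡0 a a+cb≡0)))
  where
  a+cb≡0 : a ℕ.+ c ℕ.* suc b ≡ 0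
  a+cb≡0 = ℕₚ.suc-injective (ℤₚ.+-injective (trans (sym (pos-+-* (suc a) c (suc b))) sum≡1))

positive-factor : ∀ k y → 0ℤ < + k * y → 0ℤ < y
positive-factor k y 0<ky = ℤₚ.*-cancelˡ-<-nonNeg (+ k) (subst (_< + k * y) (sym (ℤₚ.*-zeroʳ (+ k))) 0<ky)

0<m-n⇒n<m : ∀ m n → 0ℤ < + m - + n → n ℕ.< m
0<m-n⇒n<m m n 0<m-n with n ℕ.<? m
... | yes n<m = n<m
... | no  n≮m = ⊥-elim (ℤₚ.<⇒≱ 0<m-n (ℤₚ.i≤j⇒i-j≤0 (+≤+ (ℕₚ.≮⇒≥ n≮m))))

-- The root lattice and simple reflections

infixl 6 _⊕_
infixr 7 _⊙_

_⊕_ : ∀ {n} → (Fin n → ℤ) → (Fin n → ℤ) → Fin n → ℤ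
(x ⊕ y) k = x k + y k

_⊙_ : ∀ {n} → ℤ → (Fin n → ℤ) → Fin n → ℤ
(c ⊙ x) k = c * x k

NonNeg NonPos : ∀ {n} → (Fin n → ℤ) → Set
NonNeg x = ∀ k → 0ℤ ≤ x k
NonPos x = ∀ k → x k ≤ 0ℤ

NonNeg? : ∀ {n} (x : Fin n → ℤ) → Dec (NonNeg x)
NonNeg? x = Finₚ.all? (λ k → 0ℤ ℤ.≤? x k)

module Reflection {n : ℕ} (A : Fin n → Fin n → ℤ) where

  ⟨_,_∨⟩ : Lat A → Fin n → ℤ
  ⟨ v , j ∨⟩ = ∑ (λ i → v i * A i j)

  e-diagonal : ∀ j → e A j j ≡ 1ℤ
  e-diagonal j with j ≟ j
  ... | yes _   = refl
  ... | no  j≢j = ⊥-elim (j≢j refl)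

  e-offdiagonal : ∀ {j k} → k ≢ j → e A j k ≡ 0ℤ
  e-offdiagonal {j} {k} k≢j with k ≟ j
  ... | yes k≡j = ⊥-elim (k≢j k≡j)
  ... | no _    = refl

  e-nonneg : ∀ j → NonNeg (e A j)
  e-nonneg j k with k ≟ j
  ... | yes _ = +≤+ z≤n
  ... | no  _ = +≤+ z≤n

  e-injective : ∀ {i j} → e A i ≗ e A j → i ≡ j
  e-injective {i} {j} eᵢ≗eⱼ with i ≟ j
  ... | yes i≡j = i≡j
  ... | no i≢j  with () ← trans (sym (e-diagonal i)) (trans (eᵢ≗eⱼ i) (e-offdiagonal i≢j))

  ∑-e-* : ∀ j (f : Fin n → ℤ) → ∑ (λ i → e A j i * f i) ≡ f j
  ∑-e-* j f = trans (∑-single _ j (λ i i≢j → cong (_* f i) (e-offdiagonal i≢j)))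
                    (trans (cong (_* f j) (e-diagonal j)) (ℤₚ.*-identityˡ (f j)))

  ∑-*-e : ∀ (x : Lat A) k → ∑ (λ j → x j * e A j k) ≡ x k
  ∑-*-e x k = trans (∑-single _ k (λ j j≢k → trans (cong (x j *_) (e-offdiagonal (j≢k ∘ sym))) (ℤₚ.*-zeroʳ (x j))))
                    (trans (cong (x k *_) (e-diagonal k)) (ℤₚ.*-identityʳ (x k)))

  pairing-e : ∀ i j → ⟨ e A i , j ∨⟩ ≡ A i j
  pairing-e i j = ∑-e-* i (λ l → A l j)

  pairing-cong : ∀ {x y} → x ≗ y → ∀ j → ⟨ x , j ∨⟩ ≡ ⟨ y , j ∨⟩
  pairing-cong x≗y j = ∑-cong (λ i → cong (_* A i j) (x≗y i))

  pairing-⊕ : ∀ x y j → ⟨ x ⊕ y , j ∨⟩ ≡ ⟨ x , j ∨⟩ + ⟨ y , j ∨⟩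
  pairing-⊕ x y j = trans (∑-cong (λ i → ℤₚ.*-distribʳ-+ (A i j) (x i) (y i)))
                          (∑-+ (λ i → x i * A i j) (λ i → y i * A i j))

  pairing-⊙ : ∀ c x j → ⟨ c ⊙ x , j ∨⟩ ≡ c * ⟨ x , j ∨⟩
  pairing-⊙ c x j = trans (∑-cong (λ i → ℤₚ.*-assoc c (x i) (A i j))) (∑-*ˡ c (λ i → x i * A i j))

  sref-formula : ∀ j v k → sref A j v k ≡ v k - ⟨ v , j ∨⟩ * e A j k
  sref-formula j v k with k ≟ j
  ... | yes _ = cong (λ a → v k - a) (sym (ℤₚ.*-identityʳ ⟨ v , j ∨⟩))
  ... | no _  = sym (trans (cong (λ a → v k - a) (ℤₚ.*-zeroʳ ⟨ v , j ∨⟩)) (ℤₚ.+-identityʳ (v k)))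

  sref-as-⊕ : ∀ j v → sref A j v ≗ v ⊕ (- ⟨ v , j ∨⟩) ⊙ e A j
  sref-as-⊕ j v k = trans (sref-formula j v k) (cong (λ a → v k + a) (ℤₚ.neg-distribˡ-* ⟨ v , j ∨⟩ (e A j k)))

  pairing-sref : ∀ j x l → ⟨ sref A j x , l ∨⟩ ≡ ⟨ x , l ∨⟩ - ⟨ x , j ∨⟩ * A j l
  pairing-sref j x l = begin
    ⟨ sref A j x , l ∨⟩                     ≡⟨ pairing-cong (sref-as-⊕ j x) l ⟩
    ⟨ x ⊕ (- p) ⊙ e A j , l ∨⟩              ≡⟨ pairing-⊕ x ((- p) ⊙ e A j) l ⟩
    ⟨ x , l ∨⟩ + ⟨ (- p) ⊙ e A j , l ∨⟩     ≡⟨ cong (λ a → ⟨ x , l ∨⟩ + a) (pairing-⊙ (- p) (e A j) l) ⟩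
    ⟨ x , l ∨⟩ + (- p) * ⟨ e A j , l ∨⟩     ≡⟨ cong (λ a → ⟨ x , l ∨⟩ + (- p) * a) (pairing-e j l) ⟩
    ⟨ x , l ∨⟩ + (- p) * A j l              ≡⟨ cong (λ a → ⟨ x , l ∨⟩ + a) (sym (ℤₚ.neg-distribˡ-* p (A j l))) ⟩
    ⟨ x , l ∨⟩ - p * A j l                  ∎
    where
    open ≡-Reasoning
    p : ℤ
    p = ⟨ x , j ∨⟩

  sref-cong : ∀ j {x y} → x ≗ y → sref A j x ≗ sref A j y
  sref-cong j {x} {y} x≗y k = begin
    sref A j x k                     ≡⟨ sref-formula j x k ⟩
    x k - ⟨ x , j ∨⟩ * e A j k       ≡⟨ cong₂ (λ a b → a - b * e A j k) (x≗y k) (pairing-cong x≗y j) ⟩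
    y k - ⟨ y , j ∨⟩ * e A j k       ≡⟨ sym (sref-formula j y k) ⟩
    sref A j y k                     ∎
    where open ≡-Reasoning

  sref-⊕ : ∀ j x y → sref A j (x ⊕ y) ≗ sref A j x ⊕ sref A j y
  sref-⊕ j x y k = begin
    sref A j (x ⊕ y) k                                          ≡⟨ sref-formula j (x ⊕ y) k ⟩
    (x k + y k) - ⟨ x ⊕ y , j ∨⟩ * e A j k                      ≡⟨ cong (λ a → (x k + y k) - a * e A j k) (pairing-⊕ x y j) ⟩
    (x k + y k) - (⟨ x , j ∨⟩ + ⟨ y , j ∨⟩) * e A j k           ≡⟨ sub-*-additive (x k) (y k) ⟨ x , j ∨⟩ ⟨ y , j ∨⟩ (e A j k) ⟩
    (x k - ⟨ x , j ∨⟩ * e A j k) + (y k - ⟨ y , j ∨⟩ * e A j k) ≡⟨ sym (cong₂ _+_ (sref-formula j x k) (sref-formula j y k)) ⟩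
    sref A j x k + sref A j y k                                 ∎
    where open ≡-Reasoning

  sref-⊙ : ∀ j c x → sref A j (c ⊙ x) ≗ c ⊙ sref A j x
  sref-⊙ j c x k = begin
    sref A j (c ⊙ x) k                       ≡⟨ sref-formula j (c ⊙ x) k ⟩
    c * x k - ⟨ c ⊙ x , j ∨⟩ * e A j k       ≡⟨ cong (λ a → c * x k - a * e A j k) (pairing-⊙ c x j) ⟩
    c * x k - (c * ⟨ x , j ∨⟩) * e A j k     ≡⟨ sub-*-homogeneous c (x k) ⟨ x , j ∨⟩ (e A j k) ⟩
    c * (x k - ⟨ x , j ∨⟩ * e A j k)         ≡⟨ cong (c *_) (sym (sref-formula j x k)) ⟩
    c * sref A j x k                         ∎
    where open ≡-Reasoning

  act-cong : ∀ w {x y} → x ≗ y → act A w x ≗ act A w y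
  act-cong []      x≗y = x≗y
  act-cong (j ∷ w) x≗y = sref-cong j (act-cong w x≗y)

  act-++ : ∀ u v x → act A (u ++ v) x ≡ act A u (act A v x)
  act-++ []      v x = refl
  act-++ (j ∷ u) v x = cong (sref A j) (act-++ u v x)

  act-⊕ : ∀ w x y → act A w (x ⊕ y) ≗ act A w x ⊕ act A w y
  act-⊕ []      x y k = refl
  act-⊕ (j ∷ w) x y k = trans (sref-cong j (act-⊕ w x y) k) (sref-⊕ j (act A w x) (act A w y) k)

  act-⊙ : ∀ w c x → act A w (c ⊙ x) ≗ c ⊙ act A w x
  act-⊙ []      c x k = refl
  act-⊙ (j ∷ w) c x k = trans (sref-cong j (act-⊙ w c x) k) (sref-⊙ j c (act A w x) k)

  act-zero : ∀ w → act A w (λ _ → 0ℤ) ≗ λ _ → 0ℤ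
  act-zero w = act-⊙ w 0ℤ (λ _ → 0ℤ)

  act-∑ : ∀ w {m} (g : Fin m → Lat A) → act A w (λ k → ∑ (λ j → g j k)) ≗ λ k → ∑ (λ j → act A w (g j) k)
  act-∑ w {zero}  g = act-zero w
  act-∑ w {suc m} g k = trans (act-⊕ w (g Fin.zero) (λ k → ∑ (λ j → g (Fin.suc j) k)) k)
                              (cong (λ a → act A w (g Fin.zero) k + a) (act-∑ w (g ∘ Fin.suc) k))

  act-expand : ∀ w x k → act A w x k ≡ ∑ (λ j → x j * act A w (e A j) k)
  act-expand w x k = begin
    act A w x k                                  ≡⟨ act-cong w (λ k → sym (∑-*-e x k)) k ⟩
    act A w (λ k → ∑ (λ j → x j * e A j k)) k    ≡⟨ act-∑ w (λ j → x j ⊙ e A j) k ⟩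
    ∑ (λ j → act A w (x j ⊙ e A j) k)            ≡⟨ ∑-cong (λ j → act-⊙ w (x j) (e A j) k) ⟩
    ∑ (λ j → x j * act A w (e A j) k)            ∎
    where open ≡-Reasoning

  act-outside : ∀ w x {k} → All (k ≢_) w → act A w x k ≡ x k
  act-outside []      x []           = refl
  act-outside (j ∷ w) x {k} (k≢j ∷ ks) = begin
    sref A j (act A w x) k                                    ≡⟨ sref-formula j (act A w x) k ⟩
    act A w x k - ⟨ act A w x , j ∨⟩ * e A j k                ≡⟨ cong (λ a → act A w x k - ⟨ act A w x , j ∨⟩ * a) (e-offdiagonal k≢j) ⟩
    act A w x k - ⟨ act A w x , j ∨⟩ * 0ℤ                     ≡⟨ cong (λ a → act A w x k - a) (ℤₚ.*-zeroʳ ⟨ act A w x , j ∨⟩) ⟩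
    act A w x k - 0ℤ                                          ≡⟨ ℤₚ.+-identityʳ (act A w x k) ⟩
    act A w x k                                               ≡⟨ act-outside w x ks ⟩
    x k                                                       ∎
    where open ≡-Reasoning

  zero-except : ∀ j {Z : Lat A} → Z j ≡ 0ℤ → (∀ {k} → k ≢ j → Z k ≡ 0ℤ) → Z ≗ λ _ → 0ℤ
  zero-except j Zⱼ≡0 Zₖ≡0 k with k ≟ j
  ... | yes refl = Zⱼ≡0
  ... | no  k≢j  = Zₖ≡0 k≢j

  unit-indecomposable : ∀ j {X Y : Lat A} {c} → NonNeg X → NonNeg Y → 0ℤ < c → e A j ≗ X ⊕ c ⊙ Y →
                        X ≗ (λ _ → 0ℤ) ⊎ Y ≗ (λ _ → 0ℤ)
  unit-indecomposable j {X} {Y} X≥0 Y≥0 0<c eⱼ≗ =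
    Sum.map (λ Xⱼ≡0 → zero-except j Xⱼ≡0 (proj₁ ∘ elsewhere)) (λ Yⱼ≡0 → zero-except j Yⱼ≡0 (proj₂ ∘ elsewhere))
            (nonneg-sum-one (X≥0 j) (Y≥0 j) 0<c (trans (sym (eⱼ≗ j)) (e-diagonal j)))
    where
    elsewhere : ∀ {k} → k ≢ j → X k ≡ 0ℤ × Y k ≡ 0ℤ
    elsewhere {k} k≢j = nonneg-sum-zero (X≥0 k) (Y≥0 k) 0<c (trans (sym (eⱼ≗ k)) (e-offdiagonal k≢j))

  module Involution (diag : ∀ i → A i i ≡ + 2) where

    sref-involutive : ∀ j x → sref A j (sref A j x) ≗ x
    sref-involutive j x k = begin
      sref A j (sref A j x) k                               ≡⟨ sref-formula j (sref A j x) k ⟩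
      sref A j x k - ⟨ sref A j x , j ∨⟩ * e A j k          ≡⟨ cong₂ (λ a b → a - b * e A j k) (sref-formula j x k) (pairing-sref j x j) ⟩
      (x k - p * e A j k) - (p - p * A j j) * e A j k       ≡⟨ cong (λ a → (x k - p * e A j k) - (p - p * a) * e A j k) (diag j) ⟩
      (x k - p * e A j k) - (p - p * + 2) * e A j k         ≡⟨ cancel (x k) p (e A j k) ⟩
      x k                                                   ∎
      where
      open ≡-Reasoning
      p : ℤ
      p = ⟨ x , j ∨⟩
      cancel : ∀ a p e → (a - p * e) - (p - p * + 2) * e ≡ a
      cancel = solve-∀

    act-reverse-act : ∀ w x → act A (reverse w) (act A w x) ≗ x
    act-reverse-act []      x k = refl
    act-reverse-act (j ∷ w) x k = begin
      act A (reverse (j ∷ w)) (sref A j (act A w x)) k          ≡⟨ cong (λ u → act A u (sref A j (act A w x)) k) (Listₚ.unfold-reverse j w) ⟩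
      act A (reverse w ∷ʳ j) (sref A j (act A w x)) k           ≡⟨ cong (λ y → y k) (act-++ (reverse w) (j ∷ []) (sref A j (act A w x))) ⟩
      act A (reverse w) (sref A j (sref A j (act A w x))) k     ≡⟨ act-cong (reverse w) (sref-involutive j (act A w x)) k ⟩
      act A (reverse w) (act A w x) k                           ≡⟨ act-reverse-act w x k ⟩
      x k                                                       ∎
      where open ≡-Reasoning

    act-act-reverse : ∀ w x → act A w (act A (reverse w) x) ≗ x
    act-act-reverse w x k = begin
      act A w (act A (reverse w) x) k                            ≡⟨ cong (λ u → act A u (act A (reverse w) x) k) (sym (Listₚ.reverse-involutive w)) ⟩
      act A (reverse (reverse w)) (act A (reverse w) x) k        ≡⟨ act-reverse-act (reverse w) x k ⟩
      x k                                                        ∎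
      where open ≡-Reasoning

    act-injective : ∀ w {x y} → act A w x ≗ act A w y → x ≗ y
    act-injective w {x} {y} wx≗wy k = begin
      x k                                  ≡⟨ act-reverse-act w x k ⟨
      act A (reverse w) (act A w x) k      ≡⟨ act-cong (reverse w) wx≗wy k ⟩
      act A (reverse w) (act A w y) k      ≡⟨ act-reverse-act w y k ⟩
      y k                                  ∎
      where open ≡-Reasoning

    act-e-nonzero : ∀ w i → ¬ (act A w (e A i) ≗ λ _ → 0ℤ)
    act-e-nonzero w i wi≗0 with () ← trans (sym (e-diagonal i)) (act-injective w (λ k → trans (wi≗0 k) (sym (act-zero w k))) i)

  module Automorphism (π : Permutation′ n) (aut : IsDiagramAut A π) where

    e-σ : ∀ j → e A (π ⟨$⟩ʳ j) ≗ σL A π (e A j)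
    e-σ j k with k ≟ π ⟨$⟩ʳ j
    ... | yes refl = sym (trans (cong (e A j) (inverseˡ π)) (e-diagonal j))
    ... | no k≢πj  = sym (e-offdiagonal (λ π⁻¹k≡j → k≢πj (trans (sym (inverseʳ π)) (cong (π ⟨$⟩ʳ_) π⁻¹k≡j))))

    pairing-σ : ∀ x j → ⟨ σL A π x , π ⟨$⟩ʳ j ∨⟩ ≡ ⟨ x , j ∨⟩
    pairing-σ x j = trans (∑-permute _ π) (∑-cong (λ i → cong₂ _*_ (cong x (inverseˡ π)) (aut i j)))

    sref-σ : ∀ j x → sref A (π ⟨$⟩ʳ j) (σL A π x) ≗ σL A π (sref A j x)
    sref-σ j x k = begin
      sref A (π ⟨$⟩ʳ j) (σL A π x) k                                   ≡⟨ sref-formula (π ⟨$⟩ʳ j) (σL A π x) k ⟩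
      σL A π x k - ⟨ σL A π x , π ⟨$⟩ʳ j ∨⟩ * e A (π ⟨$⟩ʳ j) k         ≡⟨ cong₂ (λ a b → σL A π x k - a * b) (pairing-σ x j) (e-σ j k) ⟩
      x (π ⟨$⟩ˡ k) - ⟨ x , j ∨⟩ * e A j (π ⟨$⟩ˡ k)                     ≡⟨ sref-formula j x (π ⟨$⟩ˡ k) ⟨
      σL A π (sref A j x) k                                            ∎
      where open ≡-Reasoning

    act-σ : ∀ w x → act A (σW A π w) (σL A π x) ≗ σL A π (act A w x)
    act-σ []      x k = refl
    act-σ (j ∷ w) x k = trans (sref-cong (π ⟨$⟩ʳ j) (act-σ w x) k) (sref-σ j (act A w x) k)

    σL-injective : ∀ {x y} → σL A π x ≗ σL A π y → x ≗ y
    σL-injective {x} {y} σx≗σy k = begin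
      x k                        ≡⟨ cong x (inverseˡ π) ⟨
      x (π ⟨$⟩ˡ (π ⟨$⟩ʳ k))      ≡⟨ σx≗σy (π ⟨$⟩ʳ k) ⟩
      y (π ⟨$⟩ˡ (π ⟨$⟩ʳ k))      ≡⟨ cong y (inverseˡ π) ⟩
      y k                        ∎
      where open ≡-Reasoning

-- Words and lengths

Least : (ℕ → Set) → ℕ → Set
Least P k = P k × (∀ j → j ℕ.< k → ¬ P j)

¬¬-least : (P : ℕ → Set) → ∀ {m} → P m → ¬ ¬ ∃ (Least P)
¬¬-least P {m} = <-rec (λ m → P m → ¬ ¬ ∃ (Least P)) least-below m
  where
  least-below : ∀ m → (∀ {j} → j ℕ.< m → P j → ¬ ¬ ∃ (Least P)) → P m → ¬ ¬ ∃ (Least P)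
  least-below m rec pm = ¬¬-excluded-middle {A = ∃ λ j → j ℕ.< m × P j} >>= λ where
    (yes (j , j<m , pj)) → rec j<m pj
    (no none)            → pure (m , pm , λ j j<m pj → none (j , j<m , pj))

length-∷ʳ : ∀ {X : Set} (xs : List X) x → length (xs ∷ʳ x) ≡ suc (length xs)
length-∷ʳ xs x = trans (Listₚ.length-++ xs) (ℕₚ.+-comm (length xs) 1)

length-++-∷-< : ∀ {X : Set} (q v w : List X) x → length q ℕ.< length v → length (q ++ x ∷ w) ℕ.≤ length (v ++ w)
length-++-∷-< q v w x |q|<|v| = begin
  length (q ++ x ∷ w)             ≡⟨ Listₚ.length-++ q ⟩
  length q ℕ.+ suc (length w)     ≡⟨ ℕₚ.+-suc (length q) (length w) ⟩
  suc (length q) ℕ.+ length w     ≤⟨ ℕₚ.+-monoˡ-≤ (length w) |q|<|v| ⟩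
  length v ℕ.+ length w           ≡⟨ Listₚ.length-++ v ⟨
  length (v ++ w)                 ∎
  where open ℕₚ.≤-Reasoning

module Words {n : ℕ} (A : Fin n → Fin n → ℤ) where
  open Reflection A

  -- Equality in W, wrapped in a record so that both words can be inferred from a proof.
  infix 4 _≃_
  record _≃_ (u v : Word A) : Set where
    constructor mk≃
    field act-≗ : _≈W_ A u v
  open _≃_ public

  ≃-setoid : Setoid 0ℓ 0ℓ
  ≃-setoid = record
    { Carrier       = Word A
    ; _≈_           = _≃_
    ; isEquivalence = record
      { refl  = mk≃ λ x k → refl
      ; sym   = λ u≃v → mk≃ λ x k → sym (act-≗ u≃v x k)
      ; trans = λ u≃v v≃w → mk≃ λ x k → trans (act-≗ u≃v x k) (act-≗ v≃w x k)
      }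
    }

  open Setoid ≃-setoid public using () renaming (refl to ≃-refl; sym to ≃-sym; trans to ≃-trans; reflexive to ≃-reflexive)

  ++-cong : ∀ {u u′ v v′} → u ≃ u′ → v ≃ v′ → u ++ v ≃ u′ ++ v′
  ++-cong {u} {u′} {v} {v′} u≃u′ v≃v′ = mk≃ λ x k → begin
    act A (u ++ v) x k           ≡⟨ cong (λ y → y k) (act-++ u v x) ⟩
    act A u (act A v x) k        ≡⟨ act-cong u (act-≗ v≃v′ x) k ⟩
    act A u (act A v′ x) k       ≡⟨ act-≗ u≃u′ (act A v′ x) k ⟩
    act A u′ (act A v′ x) k      ≡⟨ cong (λ y → y k) (act-++ u′ v′ x) ⟨
    act A (u′ ++ v′) x k         ∎
    where open ≡-Reasoning

  ∷-cong : ∀ j {u v} → u ≃ v → j ∷ u ≃ j ∷ v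
  ∷-cong j = ++-cong {j ∷ []} ≃-refl

  ∷ʳ-cong : ∀ j {u v} → u ≃ v → u ∷ʳ j ≃ v ∷ʳ j
  ∷ʳ-cong j u≃v = ++-cong u≃v ≃-refl

  LengthAtLeast : Word A → ℕ → Set
  LengthAtLeast w t = ∀ u → u ≃ w → t ℕ.≤ length u

  Reduced : Word A → Set
  Reduced u = LengthAtLeast u (length u)

  -- ℓ(w) ≤ ℓ(w s_j)
  NonDescent : Word A → Fin n → Set
  NonDescent w j = ∀ u → Reduced u → u ≃ w → LengthAtLeast (w ∷ʳ j) (length u)

  LengthAtLeast-cong : ∀ {w w′ t} → w ≃ w′ → LengthAtLeast w t → LengthAtLeast w′ t
  LengthAtLeast-cong w≃w′ w≥t u u≃w′ = w≥t u (≃-trans u≃w′ (≃-sym w≃w′))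

  -- Lengths are only classically available (word equality is not decidable as stated), hence ¬ ¬.
  ¬¬-reduced : ∀ w → ¬ ¬ (∃ λ u → Reduced u × u ≃ w)
  ¬¬-reduced w = do
    (k , (u , |u|≡k , u≃w) , minimal) ← ¬¬-least (λ k → ∃ λ u → length u ≡ k × u ≃ w) (w , refl , ≃-refl)
    pure (u , (λ u′ u′≃u → subst (ℕ._≤ length u′) (sym |u|≡k)
                 (ℕₚ.≮⇒≥ λ |u′|<k → minimal (length u′) |u′|<k (u′ , refl , ≃-trans u′≃u u≃w))) , u≃w)

  reduced-++ : ∀ u v → Reduced (u ++ v) → Reduced u × Reduced v
  reduced-++ u v uv-reduced = reducedˡ , reducedʳ
    where
    reducedˡ : Reduced u
    reducedˡ u′ u′≃u = ℕₚ.+-cancelʳ-≤ (length v) (length u) (length u′) (begin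
      length u ℕ.+ length v    ≡⟨ Listₚ.length-++ u ⟨
      length (u ++ v)          ≤⟨ uv-reduced (u′ ++ v) (++-cong u′≃u ≃-refl) ⟩
      length (u′ ++ v)         ≡⟨ Listₚ.length-++ u′ ⟩
      length u′ ℕ.+ length v   ∎)
      where open ℕₚ.≤-Reasoning
    reducedʳ : Reduced v
    reducedʳ v′ v′≃v = ℕₚ.+-cancelˡ-≤ (length u) (length v) (length v′) (begin
      length u ℕ.+ length v    ≡⟨ Listₚ.length-++ u ⟨
      length (u ++ v)          ≤⟨ uv-reduced (u ++ v′) (++-cong ≃-refl v′≃v) ⟩
      length (u ++ v′)         ≡⟨ Listₚ.length-++ u ⟩
      length u ℕ.+ length v′   ∎)
      where open ℕₚ.≤-Reasoning

  reduced-≃ : ∀ {u u′} → Reduced u → u′ ≃ u → length u′ ℕ.≤ length u → Reduced u′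
  reduced-≃ {u} {u′} reduced u′≃u shorter u″ u″≃u′ = ℕₚ.≤-trans shorter (reduced u″ (≃-trans u″≃u′ u′≃u))

  NonDescent-cong : ∀ {w w′ j} → w ≃ w′ → NonDescent w j → NonDescent w′ j
  NonDescent-cong w≃w′ nondescent u reduced u≃w′ =
    LengthAtLeast-cong (∷ʳ-cong _ w≃w′) (nondescent u reduced (≃-trans u≃w′ (≃-sym w≃w′)))

  reduced⇒HasLength : ∀ {u w} → Reduced u → u ≃ w → HasLength A w (length u)
  reduced⇒HasLength {u} reduced u≃w =
    (u , refl , act-≗ u≃w) , λ u′ u′≈w → reduced u′ (≃-trans (mk≃ u′≈w) (≃-sym u≃w))

  module _ (diag : ∀ i → A i i ≡ + 2) where
    open Involution diag

    ∷-∷-cancel : ∀ j u → j ∷ j ∷ u ≃ u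
    ∷-∷-cancel j u = mk≃ λ x → sref-involutive j (act A u x)

    ∷ʳ-∷ʳ-cancel : ∀ j u → (u ∷ʳ j) ∷ʳ j ≃ u
    ∷ʳ-∷ʳ-cancel j u = begin
      (u ∷ʳ j) ∷ʳ j      ≡⟨ Listₚ.++-assoc u (j ∷ []) (j ∷ []) ⟩
      u ++ (j ∷ j ∷ [])  ≈⟨ ++-cong ≃-refl (∷-∷-cancel j []) ⟩
      u ++ []            ≡⟨ Listₚ.++-identityʳ u ⟩
      u                  ∎
      where open import Relation.Binary.Reasoning.Setoid ≃-setoid

    ∷ʳ-++-∷-cancel : ∀ j u v → (u ∷ʳ j) ++ j ∷ v ≃ u ++ v
    ∷ʳ-++-∷-cancel j u v = begin
      (u ∷ʳ j) ++ j ∷ v   ≡⟨ Listₚ.++-assoc u (j ∷ []) (j ∷ v) ⟩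
      u ++ j ∷ j ∷ v      ≈⟨ ++-cong ≃-refl (∷-∷-cancel j v) ⟩
      u ++ v              ∎
      where open import Relation.Binary.Reasoning.Setoid ≃-setoid

    last-letter-descends : ∀ r j → Reduced (r ∷ʳ j) → ¬ NonDescent (r ∷ʳ j) j
    last-letter-descends r j reduced nondescent = ℕₚ.n≮n (length r) (subst (ℕ._≤ length r) (length-∷ʳ r j)
      (nondescent (r ∷ʳ j) reduced ≃-refl r (≃-sym (∷ʳ-∷ʳ-cancel j r))))

-- Rank two

-- Under the reflections in two simple roots s and s′ a lattice vector v is tracked by the four numbers
-- ⦅ v s , v s′ , ⟨ v , s ∨⟩ , ⟨ v , s′ ∨⟩ ⦆: the two reflections act on them by `step` below and fix every
-- other coordinate of v.
data St : Set where
  ⦅_,_,_,_⦆ : ℤ → ℤ → ℤ → ℤ → St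

xₛ yₛ : St → ℤ
xₛ ⦅ x , _ , _ , _ ⦆ = x
yₛ ⦅ _ , y , _ , _ ⦆ = y

infixl 6 _+ₛ_
infixr 7 _·ₛ_

_+ₛ_ : St → St → St
⦅ x , y , p , q ⦆ +ₛ ⦅ x′ , y′ , p′ , q′ ⦆ = ⦅ x + x′ , y + y′ , p + p′ , q + q′ ⦆

_·ₛ_ : ℤ → St → St
c ·ₛ ⦅ x , y , p , q ⦆ = ⦅ c * x , c * y , c * p , c * q ⦆

_⊖_·_ : St → ℤ → St → St
⦅ x , y , p , q ⦆ ⊖ a · ⦅ x′ , y′ , p′ , q′ ⦆ = ⦅ x - a * x′ , y - a * y′ , p - a * p′ , q - a * q′ ⦆

-- Proved with cong₂ rather than by matching on refl: the latter makes the type checker normalise the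
-- ring-solver proofs St-≡ is applied to.
St-≡ : ∀ {x y p q x′ y′ p′ q′ : ℤ} → x ≡ x′ → y ≡ y′ → p ≡ p′ → q ≡ q′ → ⦅ x , y , p , q ⦆ ≡ ⦅ x′ , y′ , p′ , q′ ⦆
St-≡ e₁ e₂ e₃ e₄ = cong₂ (λ f q → f q) (cong₂ (λ f p → f p) (cong₂ ⦅_,_,_,_⦆ e₁ e₂) e₃) e₄

⊖-+ : ∀ st st′ a a′ r → (st +ₛ st′) ⊖ (a + a′) · r ≡ (st ⊖ a · r) +ₛ (st′ ⊖ a′ · r)
⊖-+ ⦅ x , y , p , q ⦆ ⦅ x′ , y′ , p′ , q′ ⦆ a a′ ⦅ r₁ , r₂ , r₃ , r₄ ⦆ =
  St-≡ (sub-*-additive x x′ a a′ r₁) (sub-*-additive y y′ a a′ r₂) (sub-*-additive p p′ a a′ r₃) (sub-*-additive q q′ a a′ r₄)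

⊖-· : ∀ c st a r → (c ·ₛ st) ⊖ (c * a) · r ≡ c ·ₛ (st ⊖ a · r)
⊖-· c ⦅ x , y , p , q ⦆ a ⦅ r₁ , r₂ , r₃ , r₄ ⦆ =
  St-≡ (sub-*-homogeneous c x a r₁) (sub-*-homogeneous c y a r₂) (sub-*-homogeneous c p a r₃) (sub-*-homogeneous c q a r₄)

E₁ E₂ E₃ E₄ : St
E₁ = ⦅ 1ℤ , 0ℤ , 0ℤ , 0ℤ ⦆
E₂ = ⦅ 0ℤ , 1ℤ , 0ℤ , 0ℤ ⦆
E₃ = ⦅ 0ℤ , 0ℤ , 1ℤ , 0ℤ ⦆
E₄ = ⦅ 0ℤ , 0ℤ , 0ℤ , 1ℤ ⦆

St-basis : ∀ x y p q → ⦅ x , y , p , q ⦆ ≡ x ·ₛ E₁ +ₛ y ·ₛ E₂ +ₛ p ·ₛ E₃ +ₛ q ·ₛ E₄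
St-basis x y p q = St-≡ (first x y p q) (second x y p q) (third x y p q) (fourth x y p q)
  where
  first : ∀ x y p q → x ≡ x * 1ℤ + y * 0ℤ + p * 0ℤ + q * 0ℤ
  first = solve-∀
  second : ∀ x y p q → y ≡ x * 0ℤ + y * 1ℤ + p * 0ℤ + q * 0ℤ
  second = solve-∀
  third : ∀ x y p q → p ≡ x * 0ℤ + y * 0ℤ + p * 1ℤ + q * 0ℤ
  third = solve-∀
  fourth : ∀ x y p q → q ≡ x * 0ℤ + y * 0ℤ + p * 0ℤ + q * 1ℤ
  fourth = solve-∀

module RankTwo (c₁ c₂ : ℤ) where

  root : Bool → St
  root true  = ⦅ 1ℤ , 0ℤ , + 2 , c₁ ⦆
  root false = ⦅ 0ℤ , 1ℤ , c₂ , + 2 ⦆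

  coroot : Bool → St → ℤ
  coroot true  ⦅ _ , _ , p , _ ⦆ = p
  coroot false ⦅ _ , _ , _ , q ⦆ = q

  step : Bool → St → St
  step b st = st ⊖ coroot b st · root b

  run : ℕ → Bool → St → St
  run zero    b st = st
  run (suc K) b st = step b (run K (not b) st)

  step-+ : ∀ b st st′ → step b (st +ₛ st′) ≡ step b st +ₛ step b st′
  step-+ true  ⦅ x , y , p , q ⦆ ⦅ x′ , y′ , p′ , q′ ⦆ = ⊖-+ ⦅ x , y , p , q ⦆ ⦅ x′ , y′ , p′ , q′ ⦆ p p′ (root true)
  step-+ false ⦅ x , y , p , q ⦆ ⦅ x′ , y′ , p′ , q′ ⦆ = ⊖-+ ⦅ x , y , p , q ⦆ ⦅ x′ , y′ , p′ , q′ ⦆ q q′ (root false)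

  step-· : ∀ b c st → step b (c ·ₛ st) ≡ c ·ₛ step b st
  step-· true  c ⦅ x , y , p , q ⦆ = ⊖-· c ⦅ x , y , p , q ⦆ p (root true)
  step-· false c ⦅ x , y , p , q ⦆ = ⊖-· c ⦅ x , y , p , q ⦆ q (root false)

  run-+ : ∀ K b st st′ → run K b (st +ₛ st′) ≡ run K b st +ₛ run K b st′
  run-+ zero    b st st′ = refl
  run-+ (suc K) b st st′ = trans (cong (step b) (run-+ K (not b) st st′)) (step-+ b (run K (not b) st) (run K (not b) st′))

  run-· : ∀ K b c st → run K b (c ·ₛ st) ≡ c ·ₛ run K b st
  run-· zero    b c st = refl
  run-· (suc K) b c st = trans (cong (step b) (run-· K (not b) c st)) (step-· b c (run K (not b) st))

  run-basis : ∀ K b x y p q → run K b ⦅ x , y , p , q ⦆ ≡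
              x ·ₛ run K b E₁ +ₛ y ·ₛ run K b E₂ +ₛ p ·ₛ run K b E₃ +ₛ q ·ₛ run K b E₄
  run-basis K b x y p q = begin
    run K b ⦅ x , y , p , q ⦆                                                  ≡⟨ cong (run K b) (St-basis x y p q) ⟩
    run K b (x ·ₛ E₁ +ₛ y ·ₛ E₂ +ₛ p ·ₛ E₃ +ₛ q ·ₛ E₄)                         ≡⟨ run-+ K b _ _ ⟩
    run K b (x ·ₛ E₁ +ₛ y ·ₛ E₂ +ₛ p ·ₛ E₃) +ₛ run K b (q ·ₛ E₄)               ≡⟨ cong₂ _+ₛ_ (run-+ K b _ _) (run-· K b q E₄) ⟩
    run K b (x ·ₛ E₁ +ₛ y ·ₛ E₂) +ₛ run K b (p ·ₛ E₃) +ₛ q ·ₛ run K b E₄      ≡⟨ cong₂ (λ u v → u +ₛ v +ₛ q ·ₛ run K b E₄) (run-+ K b _ _) (run-· K b p E₃) ⟩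
    run K b (x ·ₛ E₁) +ₛ run K b (y ·ₛ E₂) +ₛ p ·ₛ run K b E₃ +ₛ q ·ₛ run K b E₄
                                        ≡⟨ cong₂ (λ u v → u +ₛ v +ₛ p ·ₛ run K b E₃ +ₛ q ·ₛ run K b E₄) (run-· K b x E₁) (run-· K b y E₂) ⟩
    x ·ₛ run K b E₁ +ₛ y ·ₛ run K b E₂ +ₛ p ·ₛ run K b E₃ +ₛ q ·ₛ run K b E₄  ∎
    where open ≡-Reasoning

  braid-from-basis : ∀ M → run M true E₁ ≡ run M false E₁ → run M true E₂ ≡ run M false E₂ →
                     run M true E₃ ≡ run M false E₃ → run M true E₄ ≡ run M false E₄ →
                     ∀ st → run M true st ≡ run M false st
  braid-from-basis M e₁ e₂ e₃ e₄ ⦅ x , y , p , q ⦆ = begin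
    run M true ⦅ x , y , p , q ⦆                                                              ≡⟨ run-basis M true x y p q ⟩
    x ·ₛ run M true E₁ +ₛ y ·ₛ run M true E₂ +ₛ p ·ₛ run M true E₃ +ₛ q ·ₛ run M true E₄      ≡⟨ cong₂ (λ u v → x ·ₛ u +ₛ y ·ₛ v +ₛ p ·ₛ run M true E₃ +ₛ q ·ₛ run M true E₄) e₁ e₂ ⟩
    x ·ₛ run M false E₁ +ₛ y ·ₛ run M false E₂ +ₛ p ·ₛ run M true E₃ +ₛ q ·ₛ run M true E₄    ≡⟨ cong₂ (λ u v → x ·ₛ run M false E₁ +ₛ y ·ₛ run M false E₂ +ₛ p ·ₛ u +ₛ q ·ₛ v) e₃ e₄ ⟩
    x ·ₛ run M false E₁ +ₛ y ·ₛ run M false E₂ +ₛ p ·ₛ run M false E₃ +ₛ q ·ₛ run M false E₄  ≡⟨ run-basis M false x y p q ⟨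
    run M false ⦅ x , y , p , q ⦆                                                             ∎
    where open ≡-Reasoning

  endsWith-s : ℕ → Bool → Bool
  endsWith-s zero          b = false
  endsWith-s (suc zero)    b = b
  endsWith-s (suc (suc K)) b = endsWith-s (suc K) (not b)

  endsWith-s-not : ∀ K b → endsWith-s (suc K) (not b) ≡ not (endsWith-s (suc K) b)
  endsWith-s-not zero    b = refl
  endsWith-s-not (suc K) b = endsWith-s-not K (not b)

  NonNegPair : St → Set
  NonNegPair st = 0ℤ ≤ xₛ st × 0ℤ ≤ yₛ st

  nonNegPair? : ∀ st → Dec (NonNegPair st)
  nonNegPair? st = 0ℤ ℤ.≤? xₛ st ×-dec 0ℤ ℤ.≤? yₛ st

  AltNonNeg : ℕ → Bool → Set
  AltNonNeg K b = endsWith-s K b ≡ false → NonNegPair (run K b (root true))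

  altNonNeg? : ∀ K b → Dec (AltNonNeg K b)
  altNonNeg? K b = endsWith-s K b Boolₚ.≟ false →-dec nonNegPair? (run K b (root true))

  -- m = suc m′ is the order of the product of the two reflections; nonneg-check is discharged by evaluation.
  record FiniteDihedral : Set where
    field
      m′           : ℕ
      braid        : ∀ st → run (suc m′) true st ≡ run (suc m′) false st
      nonneg-check : True (Finₚ.all? λ (K : Fin (suc m′)) → altNonNeg? (toℕ K) true ×-dec altNonNeg? (toℕ K) false)

    m : ℕ
    m = suc m′

    alt-nonneg : ∀ K b → K ℕ.< m → AltNonNeg K b
    alt-nonneg K true  K<m = subst (λ k → AltNonNeg k true) (Finₚ.toℕ-fromℕ< K<m) (proj₁ (toWitness nonneg-check (fromℕ< K<m)))
    alt-nonneg K false K<m = subst (λ k → AltNonNeg k false) (Finₚ.toℕ-fromℕ< K<m) (proj₂ (toWitness nonneg-check (fromℕ< K<m)))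

A₁×A₁ : RankTwo.FiniteDihedral 0ℤ 0ℤ
A₁×A₁ = record { m′ = 1 ; braid = RankTwo.braid-from-basis _ _ 2 refl refl refl refl ; nonneg-check = _ }

A₂ : RankTwo.FiniteDihedral -[1+ 0 ] -[1+ 0 ]
A₂ = record { m′ = 2 ; braid = RankTwo.braid-from-basis _ _ 3 refl refl refl refl ; nonneg-check = _ }

B₂ : RankTwo.FiniteDihedral -[1+ 0 ] -[1+ 1 ]
B₂ = record { m′ = 3 ; braid = RankTwo.braid-from-basis _ _ 4 refl refl refl refl ; nonneg-check = _ }

C₂ : RankTwo.FiniteDihedral -[1+ 1 ] -[1+ 0 ]
C₂ = record { m′ = 3 ; braid = RankTwo.braid-from-basis _ _ 4 refl refl refl refl ; nonneg-check = _ }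

G₂ : RankTwo.FiniteDihedral -[1+ 0 ] -[1+ 2 ]
G₂ = record { m′ = 5 ; braid = RankTwo.braid-from-basis _ _ 6 refl refl refl refl ; nonneg-check = _ }

G₂′ : RankTwo.FiniteDihedral -[1+ 2 ] -[1+ 0 ]
G₂′ = record { m′ = 5 ; braid = RankTwo.braid-from-basis _ _ 6 refl refl refl refl ; nonneg-check = _ }

finiteDihedral-negative : ∀ a b → a ℕ.< 3 → b ℕ.< 3 → suc a ℕ.* suc b ℕ.< 4 → RankTwo.FiniteDihedral -[1+ a ] -[1+ b ]
finiteDihedral-negative 0 0 _ _ _ = A₂
finiteDihedral-negative 0 1 _ _ _ = B₂
finiteDihedral-negative 1 0 _ _ _ = C₂
finiteDihedral-negative 0 2 _ _ _ = G₂
finiteDihedral-negative 2 0 _ _ _ = G₂′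
finiteDihedral-negative 1 1 _ _ (s≤s (s≤s (s≤s (s≤s ()))))
finiteDihedral-negative 1 2 _ _ (s≤s (s≤s (s≤s (s≤s ()))))
finiteDihedral-negative 2 1 _ _ (s≤s (s≤s (s≤s (s≤s ()))))
finiteDihedral-negative 2 2 _ _ (s≤s (s≤s (s≤s (s≤s ()))))
finiteDihedral-negative (suc (suc (suc _))) _ (s≤s (s≤s (s≤s ()))) _ _
finiteDihedral-negative _ (suc (suc (suc _))) _ (s≤s (s≤s (s≤s ()))) _

finiteDihedral : ∀ {c₁ c₂ d₁ d₂} → 1 ℕ.≤ d₁ → 1 ℕ.≤ d₂ → c₁ ≤ 0ℤ → c₂ ≤ 0ℤ →
                 c₁ * + d₂ ≡ c₂ * + d₁ → 0ℤ < + 4 - c₁ * c₂ → RankTwo.FiniteDihedral c₁ c₂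
finiteDihedral {+ 0}      {+ 0}      _       _       _          _          _  _ = A₁×A₁
finiteDihedral {+ 0}      { -[1+ _ ]} (s≤s _) (s≤s _) _          _          () _
finiteDihedral { -[1+ _ ]} {+ 0}      (s≤s _) (s≤s _) _          _          () _
finiteDihedral {+[1+ _ ]} {_}        _       _       (+≤+ ())   _          _  _
finiteDihedral {_}        {+[1+ _ ]} _       _       _          (+≤+ ())   _  _
finiteDihedral { -[1+ a ]} { -[1+ b ]} _     _       _          _          _  0<4-c₁c₂ =
  finiteDihedral-negative a b (below-3 (ℕₚ.m≤m*n (suc a) (suc b))) (below-3 (ℕₚ.m≤n*m (suc b) (suc a))) ab<4
  where
  ab<4 : suc a ℕ.* suc b ℕ.< 4
  ab<4 = 0<m-n⇒n<m 4 (suc a ℕ.* suc b) 0<4-c₁c₂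
  below-3 : ∀ {k} → suc k ℕ.≤ suc a ℕ.* suc b → k ℕ.< 3
  below-3 k<ab = ℕₚ.≤-pred (ℕₚ.≤-<-trans k<ab ab<4)

module Dihedral {n : ℕ} (A : Fin n → Fin n → ℤ) (cartan : IsFiniteCartan A) (s s′ : Fin n) (s≢s′ : s ≢ s′) where
  open IsFiniteCartan cartan
  open Reflection A
  open Words A
  open RankTwo (A s s′) (A s′ s)

  s′≢s : s′ ≢ s
  s′≢s = s≢s′ ∘ sym

  combination-at-s : ∀ a b → (a ⊙ e A s ⊕ b ⊙ e A s′) s ≡ a
  combination-at-s a b = begin
    a * e A s s + b * e A s′ s   ≡⟨ cong₂ (λ x y → a * x + b * y) (e-diagonal s) (e-offdiagonal s≢s′) ⟩
    a * 1ℤ + b * 0ℤ              ≡⟨ cong₂ _+_ (ℤₚ.*-identityʳ a) (ℤₚ.*-zeroʳ b) ⟩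
    a + 0ℤ                       ≡⟨ ℤₚ.+-identityʳ a ⟩
    a                            ∎
    where open ≡-Reasoning

  combination-at-s′ : ∀ a b → (a ⊙ e A s ⊕ b ⊙ e A s′) s′ ≡ b
  combination-at-s′ a b = begin
    a * e A s s′ + b * e A s′ s′   ≡⟨ cong₂ (λ x y → a * x + b * y) (e-offdiagonal s′≢s) (e-diagonal s′) ⟩
    a * 0ℤ + b * 1ℤ                ≡⟨ cong₂ _+_ (ℤₚ.*-zeroʳ a) (ℤₚ.*-identityʳ b) ⟩
    0ℤ + b                         ≡⟨ ℤₚ.+-identityˡ b ⟩
    b                              ∎
    where open ≡-Reasoning

  combination-outside : ∀ a b {k} → k ≢ s → k ≢ s′ → (a ⊙ e A s ⊕ b ⊙ e A s′) k ≡ 0ℤ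
  combination-outside a b {k} k≢s k≢s′ = begin
    a * e A s k + b * e A s′ k   ≡⟨ cong₂ (λ x y → a * x + b * y) (e-offdiagonal k≢s) (e-offdiagonal k≢s′) ⟩
    a * 0ℤ + b * 0ℤ              ≡⟨ cong₂ _+_ (ℤₚ.*-zeroʳ a) (ℤₚ.*-zeroʳ b) ⟩
    0ℤ                           ∎
    where open ≡-Reasoning

  ∑-combination : ∀ a b (f : Fin n → ℤ) → ∑ (λ i → (a ⊙ e A s ⊕ b ⊙ e A s′) i * f i) ≡ a * f s + b * f s′
  ∑-combination a b f = begin
    ∑ (λ i → (a * e A s i + b * e A s′ i) * f i)                    ≡⟨ ∑-cong (λ i → distrib a b (e A s i) (e A s′ i) (f i)) ⟩
    ∑ (λ i → a * (e A s i * f i) + b * (e A s′ i * f i))            ≡⟨ ∑-+ (λ i → a * (e A s i * f i)) (λ i → b * (e A s′ i * f i)) ⟩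
    ∑ (λ i → a * (e A s i * f i)) + ∑ (λ i → b * (e A s′ i * f i))  ≡⟨ cong₂ _+_ (∑-*ˡ a (λ i → e A s i * f i)) (∑-*ˡ b (λ i → e A s′ i * f i)) ⟩
    a * ∑ (λ i → e A s i * f i) + b * ∑ (λ i → e A s′ i * f i)      ≡⟨ cong₂ (λ u v → a * u + b * v) (∑-e-* s f) (∑-e-* s′ f) ⟩
    a * f s + b * f s′                                              ∎
    where
    open ≡-Reasoning
    distrib : ∀ a b x y z → (a * x + b * y) * z ≡ a * (x * z) + b * (y * z)
    distrib = solve-∀

  quadratic-form : ∀ a b (B : Fin n → Fin n → ℤ) → let x = a ⊙ e A s ⊕ b ⊙ e A s′ in
    ∑ (λ i → ∑ (λ j → x i * x j * B i j)) ≡ a * (a * B s s + b * B s s′) + b * (a * B s′ s + b * B s′ s′)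
  quadratic-form a b B = begin
    ∑ (λ i → ∑ (λ j → x i * x j * B i j))                          ≡⟨ ∑-cong (λ i → ∑-cong (λ j → ℤₚ.*-assoc (x i) (x j) (B i j))) ⟩
    ∑ (λ i → ∑ (λ j → x i * (x j * B i j)))                        ≡⟨ ∑-cong (λ i → ∑-*ˡ (x i) (λ j → x j * B i j)) ⟩
    ∑ (λ i → x i * ∑ (λ j → x j * B i j))                          ≡⟨ ∑-cong (λ i → cong (x i *_) (∑-combination a b (B i))) ⟩
    ∑ (λ i → x i * (a * B i s + b * B i s′))                       ≡⟨ ∑-combination a b (λ i → a * B i s + b * B i s′) ⟩
    a * (a * B s s + b * B s s′) + b * (a * B s′ s + b * B s′ s′)  ∎
    where
    open ≡-Reasoning
    x : Lat A
    x = a ⊙ e A s ⊕ b ⊙ e A s′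

  -- Positive definiteness at x = -c₂ α_s + 2 α_{s′}, where the form equals 2 d_{s′} (4 - c₁ c₂).
  0<4-c₁c₂ : 0ℤ < + 4 - A s s′ * A s′ s
  0<4-c₁c₂ = positive-factor (2 ℕ.* d s′) (+ 4 - A s s′ * A s′ s) (subst (0ℤ <_) form (posdef x (s′ , x-at-s′≢0)))
    where
    a : ℤ
    a = - A s′ s
    x : Lat A
    x = a ⊙ e A s ⊕ + 2 ⊙ e A s′
    x-at-s′≢0 : x s′ ≢ 0ℤ
    x-at-s′≢0 x-at-s′≡0 with () ← trans (sym (combination-at-s′ a (+ 2))) x-at-s′≡0
    evaluate : ∀ c₁ c₂ d d′ → (- c₂) * ((- c₂) * (+ 2 * d) + + 2 * (c₁ * d′)) + + 2 * ((- c₂) * (c₂ * d) + + 2 * (+ 2 * d′))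
                            ≡ (+ 2 * d′) * (+ 4 - c₁ * c₂)
    evaluate = solve-∀
    form : ∑ (λ i → ∑ (λ j → x i * x j * (A i j * + d j))) ≡ + (2 ℕ.* d s′) * (+ 4 - A s s′ * A s′ s)
    form = begin
      ∑ (λ i → ∑ (λ j → x i * x j * (A i j * + d j)))
        ≡⟨ quadratic-form a (+ 2) (λ i j → A i j * + d j) ⟩
      a * (a * (A s s * + d s) + + 2 * (A s s′ * + d s′)) + + 2 * (a * (A s′ s * + d s) + + 2 * (A s′ s′ * + d s′))
        ≡⟨ cong₂ (λ u v → a * (a * (u * + d s) + + 2 * (A s s′ * + d s′)) + + 2 * (a * (A s′ s * + d s) + + 2 * (v * + d s′)))
                 (diag s) (diag s′) ⟩
      a * (a * (+ 2 * + d s) + + 2 * (A s s′ * + d s′)) + + 2 * (a * (A s′ s * + d s) + + 2 * (+ 2 * + d s′))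
        ≡⟨ evaluate (A s s′) (A s′ s) (+ d s) (+ d s′) ⟩
      (+ 2 * + d s′) * (+ 4 - A s s′ * A s′ s)
        ≡⟨ cong (_* (+ 4 - A s s′ * A s′ s)) (ℤₚ.pos-* 2 (d s′)) ⟨
      + (2 ℕ.* d s′) * (+ 4 - A s s′ * A s′ s)
        ∎
      where open ≡-Reasoning

  finite : FiniteDihedral
  finite = finiteDihedral (d-pos s) (d-pos s′) (offdiag s s′ s≢s′) (offdiag s′ s s′≢s) (symm s s′) 0<4-c₁c₂

  letter : Bool → Fin n
  letter true  = s
  letter false = s′

  alt : ℕ → Bool → Word A
  alt zero    b = []
  alt (suc K) b = letter b ∷ alt K (not b)

  length-alt : ∀ K b → length (alt K b) ≡ K
  length-alt zero    b = refl
  length-alt (suc K) b = cong suc (length-alt K (not b))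

  InPair : Fin n → Set
  InPair j = j ≡ s ⊎ j ≡ s′

  letter-of : ∀ {j} → InPair j → ∃ λ c → j ≡ letter c
  letter-of (inj₁ refl) = true , refl
  letter-of (inj₂ refl) = false , refl

  alt-inPair : ∀ K b → All InPair (alt K b)
  alt-inPair zero    b     = []
  alt-inPair (suc K) true  = inj₁ refl ∷ alt-inPair K false
  alt-inPair (suc K) false = inj₂ refl ∷ alt-inPair K true

  outside-pair : ∀ {k u} → k ≢ s → k ≢ s′ → All InPair u → All (k ≢_) u
  outside-pair k≢s k≢s′ = All.map λ where
    (inj₁ refl) → k≢s
    (inj₂ refl) → k≢s′

  ≗-by-coordinates : ∀ {x y : Lat A} → x s ≡ y s → x s′ ≡ y s′ → (∀ k → k ≢ s → k ≢ s′ → x k ≡ y k) → x ≗ y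
  ≗-by-coordinates eq-s eq-s′ eq-rest k with k ≟ s | k ≟ s′
  ... | yes refl | _        = eq-s
  ... | no _     | yes refl = eq-s′
  ... | no k≢s   | no k≢s′  = eq-rest k k≢s k≢s′

  state : Lat A → St
  state v = ⦅ v s , v s′ , ⟨ v , s ∨⟩ , ⟨ v , s′ ∨⟩ ⦆

  state-sref : ∀ j v → state (sref A j v) ≡ state v ⊖ ⟨ v , j ∨⟩ · state (e A j)
  state-sref j v = St-≡ (sref-formula j v s) (sref-formula j v s′) (pairing-sref′ s) (pairing-sref′ s′)
    where
    pairing-sref′ : ∀ l → ⟨ sref A j v , l ∨⟩ ≡ ⟨ v , l ∨⟩ - ⟨ v , j ∨⟩ * ⟨ e A j , l ∨⟩
    pairing-sref′ l = trans (pairing-sref j v l) (cong (λ a → ⟨ v , l ∨⟩ - ⟨ v , j ∨⟩ * a) (sym (pairing-e j l)))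

  state-e : ∀ b → state (e A (letter b)) ≡ root b
  state-e true  = St-≡ (e-diagonal s) (e-offdiagonal s′≢s) (trans (pairing-e s s) (diag s)) (pairing-e s s′)
  state-e false = St-≡ (e-offdiagonal s≢s′) (e-diagonal s′) (pairing-e s′ s) (trans (pairing-e s′ s′) (diag s′))

  state-step : ∀ b v → state (sref A (letter b) v) ≡ step b (state v)
  state-step true  v = trans (state-sref s v) (cong (state v ⊖ ⟨ v , s ∨⟩ ·_) (state-e true))
  state-step false v = trans (state-sref s′ v) (cong (state v ⊖ ⟨ v , s′ ∨⟩ ·_) (state-e false))

  state-act : ∀ K b v → state (act A (alt K b) v) ≡ run K b (state v)
  state-act zero    b v = refl
  state-act (suc K) b v = trans (state-step b (act A (alt K (not b)) v)) (cong (step b) (state-act K (not b) v))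

  alt-≃ : ∀ M b b′ → (∀ st → run M b st ≡ run M b′ st) → alt M b ≃ alt M b′
  alt-≃ M b b′ same-run = mk≃ λ x → ≗-by-coordinates (cong xₛ (same-state x)) (cong yₛ (same-state x)) λ k k≢s k≢s′ →
    trans (act-outside (alt M b) x (outside-pair k≢s k≢s′ (alt-inPair M b)))
          (sym (act-outside (alt M b′) x (outside-pair k≢s k≢s′ (alt-inPair M b′))))
    where
    same-state : ∀ x → state (act A (alt M b) x) ≡ state (act A (alt M b′) x)
    same-state x = trans (state-act M b x) (trans (same-run (state x)) (sym (state-act M b′ x)))

  alt-coefficients : ∀ K b → act A (alt K b) (e A s) ≗ xₛ (run K b (root true)) ⊙ e A s ⊕ yₛ (run K b (root true)) ⊙ e A s′
  alt-coefficients K b = ≗-by-coordinates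
    (trans (cong xₛ final-state) (sym (combination-at-s x y)))
    (trans (cong yₛ final-state) (sym (combination-at-s′ x y)))
    (λ k k≢s k≢s′ → trans (act-outside (alt K b) (e A s) (outside-pair k≢s k≢s′ (alt-inPair K b)))
                          (trans (e-offdiagonal k≢s) (sym (combination-outside x y k≢s k≢s′))))
    where
    x y : ℤ
    x = xₛ (run K b (root true))
    y = yₛ (run K b (root true))
    final-state : state (act A (alt K b) (e A s)) ≡ run K b (root true)
    final-state = trans (state-act K b (e A s)) (cong (run K b) (state-e true))

  repeat-not-reduced : ∀ j u → ¬ Reduced (j ∷ j ∷ u)
  repeat-not-reduced j u reduced = ℕₚ.n≮n (length u) (ℕₚ.≤-trans (ℕₚ.n≤1+n _) (reduced u (≃-sym (∷-∷-cancel diag j u))))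

  reduced-alternating : ∀ u → All InPair u → Reduced u → ∃₂ λ K b → u ≡ alt K b
  reduced-alternating []      []        _       = 0 , true , refl
  reduced-alternating (j ∷ u) (j∈ ∷ u∈) reduced
    with letter-of j∈ | reduced-alternating u u∈ (proj₂ (reduced-++ (j ∷ []) u reduced))
  ... | c , refl | zero  , b , refl = 1 , c , refl
  ... | c , refl | suc K , b , refl = extend c b reduced
    where
    extend : ∀ c b → Reduced (letter c ∷ alt (suc K) b) → ∃₂ λ K′ b′ → letter c ∷ alt (suc K) b ≡ alt K′ b′
    extend true  false _ = suc (suc K) , true , refl
    extend false true  _ = suc (suc K) , false , refl
    extend true  true  r = ⊥-elim (repeat-not-reduced s (alt K false) r)
    extend false false r = ⊥-elim (repeat-not-reduced s′ (alt K true) r)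

  alt-ending : ∀ K b → endsWith-s K b ≡ true → ∃ λ q → alt K b ≡ q ∷ʳ s × suc (length q) ≡ K
  alt-ending (suc zero)    true ends = [] , refl , refl
  alt-ending (suc (suc K)) b    ends with q , alt≡qs , |q|<K ← alt-ending (suc K) (not b) ends =
    letter b ∷ q , cong (letter b ∷_) alt≡qs , cong suc |q|<K

  ending-in-s-descends : ∀ K b {w} → endsWith-s K b ≡ true → alt K b ≃ w → ¬ LengthAtLeast (w ∷ʳ s) K
  ending-in-s-descends K b {w} ends alt≃w grows with alt-ending K b ends
  ... | q , alt≡qs , |q|<K =
    ℕₚ.n≮n (length q) (subst (ℕ._≤ length q) (sym |q|<K) (grows q (≃-trans (≃-sym (∷ʳ-∷ʳ-cancel diag s q)) (∷ʳ-cong s qs≃w))))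
    where
    qs≃w : q ∷ʳ s ≃ w
    qs≃w = ≃-trans (≃-reflexive (sym alt≡qs)) alt≃w

  module WithFiniteDihedral (D : FiniteDihedral) where
    open FiniteDihedral D

    alt-braid : ∀ b → alt m b ≃ alt m (not b)
    alt-braid true  = alt-≃ m true false braid
    alt-braid false = ≃-sym (alt-≃ m true false braid)

    alt-too-long : ∀ b → ¬ Reduced (alt (suc m) b)
    alt-too-long b reduced = ℕₚ.n≮n m′ (ℕₚ.≤-trans (ℕₚ.n≤1+n (suc m′))
      (subst₂ ℕ._≤_ (length-alt (suc m) b) (length-alt m′ (not b)) (reduced (alt m′ (not b)) shorter)))
      where
      shorter : alt m′ (not b) ≃ alt (suc m) b
      shorter = ≃-sym (≃-trans (∷-cong (letter b) (≃-sym (alt-braid b))) (∷-∷-cancel diag (letter b) (alt m′ (not b))))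

    reduced-alt-≤ : ∀ K b → Reduced (alt K b) → K ℕ.≤ m
    reduced-alt-≤ zero    b _ = z≤n
    reduced-alt-≤ (suc K) b reduced with K ℕ.≟ m
    ... | yes refl = ⊥-elim (alt-too-long b reduced)
    ... | no  K≢m  = ℕₚ.≤∧≢⇒< (reduced-alt-≤ K (not b) (proj₂ (reduced-++ (letter b ∷ []) (alt K (not b)) reduced))) K≢m

    reduced-alt-nonneg : ∀ K b → Reduced (alt K b) → LengthAtLeast (alt K b ∷ʳ s) K → NonNegPair (run K b (root true))
    reduced-alt-nonneg K b reduced grows with endsWith-s K b in ends
    ... | true = ⊥-elim (ending-in-s-descends K b ends ≃-refl grows)
    ... | false with K ℕ.≟ m
    ...   | yes refl = ⊥-elim (ending-in-s-descends m (not b) (trans (endsWith-s-not m′ b) (cong not ends)) (≃-sym (alt-braid b)) grows)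
    ...   | no  K≢m  = alt-nonneg K b (ℕₚ.≤∧≢⇒< (reduced-alt-≤ K b reduced) K≢m) ends

    dihedral-nonneg : ∀ u → All InPair u → Reduced u → NonDescent u s →
                      ∃₂ λ a b → 0ℤ ≤ a × 0ℤ ≤ b × act A u (e A s) ≗ a ⊙ e A s ⊕ b ⊙ e A s′
    dihedral-nonneg u u∈ reduced nondescent with reduced-alternating u u∈ reduced
    ... | K , b , refl = _ , _ , proj₁ nonneg , proj₂ nonneg , alt-coefficients K b
      where
      nonneg : NonNegPair (run K b (root true))
      nonneg = reduced-alt-nonneg K b reduced
        (subst (LengthAtLeast (alt K b ∷ʳ s)) (length-alt K b) (nondescent (alt K b) reduced ≃-refl))

  dihedral-nonneg : ∀ u → All InPair u → Reduced u → NonDescent u s →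
                    ∃₂ λ a b → 0ℤ ≤ a × 0ℤ ≤ b × act A u (e A s) ≗ a ⊙ e A s ⊕ b ⊙ e A s′
  dihedral-nonneg = WithFiniteDihedral.dihedral-nonneg finite

-- Positivity of roots and longest elements

module Positivity {n : ℕ} (A : Fin n → Fin n → ℤ) (cartan : IsFiniteCartan A) where
  open IsFiniteCartan cartan using (diag)
  open Reflection A
  open Words A

  -- Humphreys' induction step: among the splittings u = v · w with w a word in s_j, s_t and
  -- ℓ(u) = ℓ(v) + ℓ(w), take one with v shortest.  Then neither j nor t is a descent of v, so by induction
  -- v(α_j), v(α_t) ≥ 0, while w(α_j) is a nonnegative combination of α_j and α_t by the rank-two analysis.
  module SplittingsOf (u : Word A) (j t : Fin n) (j≢t : j ≢ t) where
    open Dihedral A cartan j t j≢t using (InPair; dihedral-nonneg)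

    Splitting : ℕ → Set
    Splitting l = ∃₂ λ v w → All InPair w × Reduced (v ++ w) × v ++ w ≃ u × length v ≡ l

    module MinimalSplitting (v w : Word A) (w∈ : All InPair w) (reduced : Reduced (v ++ w)) (vw≃u : v ++ w ≃ u)
                            (minimal : ∀ l → l ℕ.< length v → ¬ Splitting l) where

      reduced-v : Reduced v
      reduced-v = proj₁ (reduced-++ v w reduced)

      reduced-w : Reduced w
      reduced-w = proj₂ (reduced-++ v w reduced)

      shortest : ∀ {l} → Splitting l → length v ℕ.≤ l
      shortest {l} split = ℕₚ.≮⇒≥ λ l<|v| → minimal l l<|v| split

      nonDescent-v : ∀ {x} → InPair x → NonDescent v x
      nonDescent-v {x} x∈ p reduced-p p≃v q q≃vx = ℕₚ.≤-trans (reduced-p v (≃-sym p≃v)) (ℕₚ.≮⇒≥ λ |q|<|v| →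
        minimal (length q) |q|<|v|
          (q , x ∷ w , x∈ ∷ w∈ , reduced-≃ reduced qxw≃vw (length-++-∷-< q v w x |q|<|v|) , ≃-trans qxw≃vw vw≃u , refl))
        where
        qxw≃vw : q ++ x ∷ w ≃ v ++ w
        qxw≃vw = ≃-trans (++-cong q≃vx ≃-refl) (∷ʳ-++-∷-cancel diag x v w)

      nonDescent-w : NonDescent u j → NonDescent w j
      nonDescent-w nondescent-u p reduced-p p≃w q q≃wj = ℕₚ.≤-trans (reduced-p w (≃-sym p≃w))
        (ℕₚ.+-cancelˡ-≤ (length v) (length w) (length q)
          (subst₂ ℕ._≤_ (Listₚ.length-++ v) (Listₚ.length-++ v) (nondescent-u (v ++ w) reduced vw≃u (v ++ q) vq≃uj)))
        where
        open import Relation.Binary.Reasoning.Setoid ≃-setoid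
        vq≃uj : v ++ q ≃ u ∷ʳ j
        vq≃uj = begin
          v ++ q          ≈⟨ ++-cong ≃-refl q≃wj ⟩
          v ++ (w ∷ʳ j)   ≡⟨ Listₚ.++-assoc v w (j ∷ []) ⟨
          (v ++ w) ∷ʳ j   ≈⟨ ∷ʳ-cong j vw≃u ⟩
          u ∷ʳ j          ∎

      act-u : ∀ {a b} → act A w (e A j) ≗ a ⊙ e A j ⊕ b ⊙ e A t → act A u (e A j) ≗ a ⊙ act A v (e A j) ⊕ b ⊙ act A v (e A t)
      act-u {a} {b} w-j k = begin
        act A u (e A j) k                                  ≡⟨ act-≗ vw≃u (e A j) k ⟨
        act A (v ++ w) (e A j) k                           ≡⟨ cong (λ y → y k) (act-++ v w (e A j)) ⟩
        act A v (act A w (e A j)) k                        ≡⟨ act-cong v w-j k ⟩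
        act A v (a ⊙ e A j ⊕ b ⊙ e A t) k                  ≡⟨ act-⊕ v (a ⊙ e A j) (b ⊙ e A t) k ⟩
        act A v (a ⊙ e A j) k + act A v (b ⊙ e A t) k      ≡⟨ cong₂ _+_ (act-⊙ v a (e A j) k) (act-⊙ v b (e A t) k) ⟩
        a * act A v (e A j) k + b * act A v (e A t) k      ∎
        where open ≡-Reasoning

      nonneg-combination : ∀ {a b} → 0ℤ ≤ a → 0ℤ ≤ b → act A w (e A j) ≗ a ⊙ e A j ⊕ b ⊙ e A t →
                           NonNeg (act A v (e A j)) → NonNeg (act A v (e A t)) → NonNeg (act A u (e A j))
      nonneg-combination {a} {b} 0≤a 0≤b w-j v-j≥0 v-t≥0 k =
        subst (0ℤ ≤_) (sym (act-u {a} {b} w-j k)) (ℤₚ.+-mono-≤ (0≤-* 0≤a (v-j≥0 k)) (0≤-* 0≤b (v-t≥0 k)))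

      ¬¬-nonneg : NonDescent u j → ¬ ¬ NonNeg (act A v (e A j)) → ¬ ¬ NonNeg (act A v (e A t)) → ¬ ¬ NonNeg (act A u (e A j))
      ¬¬-nonneg nondescent-u ¬¬v-j≥0 ¬¬v-t≥0
        with a , b , 0≤a , 0≤b , w-j ← dihedral-nonneg w w∈ reduced-w (nonDescent-w nondescent-u) =
        nonneg-combination {a} {b} 0≤a 0≤b w-j <$> ¬¬v-j≥0 ⊛ ¬¬v-t≥0

  NonNegAtLength : ℕ → Set
  NonNegAtLength k = ∀ u j → length u ≡ k → Reduced u → NonDescent u j → ¬ ¬ NonNeg (act A u (e A j))

  reduced-nonneg-step : ∀ k → (∀ {l} → l ℕ.< k → NonNegAtLength l) → NonNegAtLength k
  reduced-nonneg-step k ih u j |u|≡k reduced nondescent with initLast u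
  ... | []      = pure (e-nonneg j)
  ... | r ∷ʳ′ t with t ≟ j
  ...   | yes refl = ⊥-elim (last-letter-descends diag r t reduced nondescent)
  ...   | no  t≢j  = do
    (_ , (v , w , w∈ , reduced-vw , vw≃u , refl) , minimal) ← ¬¬-least Splitting split-off-t
    let open MinimalSplitting v w w∈ reduced-vw vw≃u minimal
        |v|<k = subst (length v ℕ.<_) (trans (sym (length-∷ʳ r t)) |u|≡k) (s≤s (shortest split-off-t))
    ¬¬-nonneg nondescent (ih |v|<k v j refl reduced-v (nonDescent-v (inj₁ refl)))
                         (ih |v|<k v t refl reduced-v (nonDescent-v (inj₂ refl)))
    where
    open SplittingsOf (r ∷ʳ t) j t (t≢j ∘ sym)
    split-off-t : Splitting (length r)
    split-off-t = r , t ∷ [] , inj₂ refl ∷ [] , reduced , ≃-refl , refl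

  nonDescent-nonneg : ∀ w j → NonDescent w j → NonNeg (act A w (e A j))
  nonDescent-nonneg w j nondescent = decidable-stable (NonNeg? (act A w (e A j))) do
    (u , reduced , u≃w) ← ¬¬-reduced w
    u-nonneg ← <-rec NonNegAtLength reduced-nonneg-step (length u) u j refl reduced (NonDescent-cong (≃-sym u≃w) nondescent)
    pure λ k → subst (0ℤ ≤_) (act-≗ u≃w (e A j) k) (u-nonneg k)

module Longest {n : ℕ} (A : Fin n → Fin n → ℤ) (cartan : IsFiniteCartan A) where
  open IsFiniteCartan cartan using (diag)
  open Reflection A
  open Words A
  open Positivity A cartan using (nonDescent-nonneg)

  longest-nonDescent : ∀ {J w j} → IsLongestIn A J w → j ∈ J → NonDescent (w ∷ʳ j) j
  longest-nonDescent {J} {w} {j} (w∈J , longest) j∈J p reduced-p p≃wj q q≃wjj = decidable-stable (length p ℕₚ.≤? length q) do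
    (r , reduced-r , r≃w) ← ¬¬-reduced w
    pure (ℕₚ.≤-trans
      (longest (w ∷ʳ j) (Allₚ.∷ʳ⁺ w∈J j∈J) (length p) (length r) (reduced⇒HasLength reduced-p p≃wj) (reduced⇒HasLength reduced-r r≃w))
      (reduced-r q (≃-trans q≃wjj (≃-trans (∷ʳ-∷ʳ-cancel diag j w) (≃-sym r≃w)))))

  sref-self : ∀ j → sref A j (e A j) ≗ -1ℤ ⊙ e A j
  sref-self j k = begin
    sref A j (e A j) k                       ≡⟨ sref-as-⊕ j (e A j) k ⟩
    e A j k + (- ⟨ e A j , j ∨⟩) * e A j k   ≡⟨ cong (λ a → e A j k + (- a) * e A j k) (trans (pairing-e j j) (diag j)) ⟩
    e A j k + (- + 2) * e A j k              ≡⟨ reflect (e A j k) ⟩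
    -1ℤ * e A j k                            ∎
    where
    open ≡-Reasoning
    reflect : ∀ x → x + (- + 2) * x ≡ -1ℤ * x
    reflect = solve-∀

  longest-nonpos : ∀ {J w j} → IsLongestIn A J w → j ∈ J → NonPos (act A w (e A j))
  longest-nonpos {J} {w} {j} longest j∈J k =
    ℤₚ.neg-cancel-≤ (subst (0ℤ ≤_) negated (nonDescent-nonneg (w ∷ʳ j) j (longest-nonDescent longest j∈J) k))
    where
    negated : act A (w ∷ʳ j) (e A j) k ≡ - act A w (e A j) k
    negated = begin
      act A (w ∷ʳ j) (e A j) k       ≡⟨ cong (λ y → y k) (act-++ w (j ∷ []) (e A j)) ⟩
      act A w (sref A j (e A j)) k   ≡⟨ act-cong w (sref-self j) k ⟩
      act A w (-1ℤ ⊙ e A j) k        ≡⟨ act-⊙ w -1ℤ (e A j) k ⟩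
      -1ℤ * act A w (e A j) k        ≡⟨ ℤₚ.-1*i≡-i (act A w (e A j) k) ⟩
      - act A w (e A j) k            ∎
      where open ≡-Reasoning

  longest-cone : ∀ {J w} {Z : Lat A} → IsLongestIn A J w → NonPos Z → (∀ {k} → k ∉ J → Z k ≡ 0ℤ) → NonNeg (act A w Z)
  longest-cone {J} {w} {Z} longest Z≤0 Z-outside k = subst (0ℤ ≤_) (sym (act-expand w Z k)) (∑-nonneg _ term-nonneg)
    where
    term-nonneg : ∀ j → 0ℤ ≤ Z j * act A w (e A j) k
    term-nonneg j with j ∈? J
    ... | yes j∈J = ≤0-* (Z≤0 j) (longest-nonpos longest j∈J k)
    ... | no  j∉J = subst (λ z → 0ℤ ≤ z * act A w (e A j) k) (sym (Z-outside j∉J)) ℤₚ.≤-refl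

-- The canonical parabolics

module _ {n : ℕ} (A : Fin n → Fin n → ℤ) (I : Subset n) where
  open Reflection A

  InAllImages : (Lat A → Lat A) → Fin n → Set
  InAllImages f i = ∀ m → ∃ λ j → j ∈ I × iter A m f (e A j) ≗ e A i

  InAllImages-⊆ : ∀ {f i} → InAllImages f i → i ∈ I
  InAllImages-⊆ {f} {i} i∈f with j , j∈I , j≗i ← i∈f 0 = subst (_∈ I) (e-injective j≗i) j∈I

  InAllImages-preimage : ∀ {f i} → (∀ {x y} → f x ≗ f y → x ≗ y) → InAllImages f i →
                         ∃ λ j → j ∈ I × f (e A j) ≗ e A i × InAllImages f j
  InAllImages-preimage {f} {i} f-injective i∈f with j , j∈I , fj≗i ← i∈f 1 = j , j∈I , fj≗i , j∈f
    where
    j∈f : InAllImages f j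
    j∈f m with j′ , j′∈I , fᵐ⁺¹j′≗i ← i∈f (suc m) = j′ , j′∈I , f-injective λ k → trans (fᵐ⁺¹j′≗i k) (sym (fj≗i k))

  InAllImages-mono : ∀ (f g : Lat A → Lat A) → (∀ {x y} → f x ≗ f y → x ≗ y) → (∀ {x y} → x ≗ y → g x ≗ g y) →
                     (∀ {i j} → i ∈ I → j ∈ I → f (e A j) ≗ e A i → g (e A j) ≗ e A i) →
                     ∀ i → InAllImages f i → InAllImages g i
  InAllImages-mono f g f-injective g-cong f⇒g i i∈f zero = i∈f zero
  InAllImages-mono f g f-injective g-cong f⇒g i i∈f (suc m)
    with j₁ , j₁∈I , fj₁≗i , j₁∈f ← InAllImages-preimage f-injective i∈f
    with j , j∈I , gᵐj≗j₁ ← InAllImages-mono f g f-injective g-cong f⇒g j₁ j₁∈f m =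
    j , j∈I , λ k → trans (g-cong gᵐj≗j₁ k) (f⇒g (InAllImages-⊆ i∈f) j₁∈I fj₁≗i k)

module CanonicalParabolic {n : ℕ} (A : Fin n → Fin n → ℤ) (cartan : IsFiniteCartan A) (π : Permutation′ n) (aut : IsDiagramAut A π)
                 (I : Subset n) (w₀ w₀I : Word A) (longest₀ : IsLongestIn A ⊤ w₀) (longestI : IsLongestIn A I w₀I) where
  open IsFiniteCartan cartan using (diag; offdiag)
  open Reflection A
  open Involution diag
  open Automorphism π aut
  open Longest A cartan

  φ₀ : Lat A → Lat A
  φ₀ = φ A π I w₀ w₀I []

  φ₀-unfold : ∀ x → φ₀ x ≗ act A (reverse w₀) (σL A π (act A (reverse w₀I) x))
  φ₀-unfold x k = begin
    act A (reverse (σW A π w₀I ++ w₀)) (σL A π x) k                 ≡⟨ cong (λ u → act A u (σL A π x) k) (Listₚ.reverse-++ (σW A π w₀I) w₀) ⟩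
    act A (reverse w₀ ++ reverse (σW A π w₀I)) (σL A π x) k         ≡⟨ cong (λ y → y k) (act-++ (reverse w₀) (reverse (σW A π w₀I)) (σL A π x)) ⟩
    act A (reverse w₀) (act A (reverse (σW A π w₀I)) (σL A π x)) k  ≡⟨ cong (λ u → act A (reverse w₀) (act A u (σL A π x)) k) (Listₚ.reverse-map (π ⟨$⟩ʳ_) w₀I) ⟨
    act A (reverse w₀) (act A (σW A π (reverse w₀I)) (σL A π x)) k  ≡⟨ act-cong (reverse w₀) (act-σ (reverse w₀I) x) k ⟩
    act A (reverse w₀) (σL A π (act A (reverse w₀I) x)) k           ∎
    where open ≡-Reasoning

  pulled-back-nonzero : ∀ v w l → ¬ (act A v (λ k → act A w (e A l) (π ⟨$⟩ʳ k)) ≗ λ _ → 0ℤ)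
  pulled-back-nonzero v w l v-pullback≗0 = act-e-nonzero w l λ m → begin
    act A w (e A l) m                        ≡⟨ cong (act A w (e A l)) (inverseʳ π) ⟨
    act A w (e A l) (π ⟨$⟩ʳ (π ⟨$⟩ˡ m))      ≡⟨ act-injective v (λ k → trans (v-pullback≗0 k) (sym (act-zero v k))) (π ⟨$⟩ˡ m) ⟩
    0ℤ                                       ∎
    where open ≡-Reasoning

  -- φ₀ maps the simple roots of I to simple roots; what is used is that φ₀(α_{i′}) is never α_i + c α_j
  -- with c > 0, since pulling such a vector back along w₀ and σ and applying w_{0,I} splits α_{i′}.
  φ₀-not-sum : ∀ {i′} → i′ ∈ I → ∀ i j {c} → 0ℤ < c → ¬ (φ₀ (e A i′) ≗ e A i ⊕ c ⊙ e A j)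
  φ₀-not-sum {i′} i′∈I i j {c} 0<c φ₀i′≗ =
    [ pulled-back-nonzero w₀I w₀ i , pulled-back-nonzero w₀I w₀ j ]′ (unit-indecomposable i′ X≥0 Y≥0 0<c i′≗X+cY)
    where
    y P Q : Lat A
    y = act A (reverse w₀I) (e A i′)
    P k = act A w₀ (e A i) (π ⟨$⟩ʳ k)
    Q k = act A w₀ (e A j) (π ⟨$⟩ʳ k)
    y≗P+cQ : y ≗ P ⊕ c ⊙ Q
    y≗P+cQ k = begin
      y k                                                     ≡⟨ cong y (inverseˡ π) ⟨
      σL A π y (π ⟨$⟩ʳ k)                                     ≡⟨ act-act-reverse w₀ (σL A π y) (π ⟨$⟩ʳ k) ⟨
      act A w₀ (act A (reverse w₀) (σL A π y)) (π ⟨$⟩ʳ k)     ≡⟨ act-cong w₀ (λ l → trans (sym (φ₀-unfold (e A i′) l)) (φ₀i′≗ l)) (π ⟨$⟩ʳ k) ⟩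
      act A w₀ (e A i ⊕ c ⊙ e A j) (π ⟨$⟩ʳ k)                 ≡⟨ act-⊕ w₀ (e A i) (c ⊙ e A j) (π ⟨$⟩ʳ k) ⟩
      P k + act A w₀ (c ⊙ e A j) (π ⟨$⟩ʳ k)                   ≡⟨ cong (λ z → P k + z) (act-⊙ w₀ c (e A j) (π ⟨$⟩ʳ k)) ⟩
      P k + c * Q k                                           ∎
      where open ≡-Reasoning
    y-outside : ∀ {k} → k ∉ I → y k ≡ 0ℤ
    y-outside {k} k∉I = begin
      y k                  ≡⟨ act-outside w₀I y (All.map (λ j∈I k≡j → k∉I (subst (_∈ I) (sym k≡j) j∈I)) (proj₁ longestI)) ⟨
      act A w₀I y k        ≡⟨ act-act-reverse w₀I (e A i′) k ⟩
      e A i′ k             ≡⟨ e-offdiagonal (λ k≡i′ → k∉I (subst (_∈ I) (sym k≡i′) i′∈I)) ⟩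
      0ℤ                   ∎
      where open ≡-Reasoning
    P≤0 : NonPos P
    P≤0 k = longest-nonpos longest₀ ∈⊤ (π ⟨$⟩ʳ k)
    Q≤0 : NonPos Q
    Q≤0 k = longest-nonpos longest₀ ∈⊤ (π ⟨$⟩ʳ k)
    PQ-outside : ∀ {k} → k ∉ I → P k ≡ 0ℤ × Q k ≡ 0ℤ
    PQ-outside {k} k∉I = nonpos-sum-zero (P≤0 k) (Q≤0 k) 0<c (trans (sym (y≗P+cQ k)) (y-outside k∉I))
    X≥0 : NonNeg (act A w₀I P)
    X≥0 = longest-cone longestI P≤0 (proj₁ ∘ PQ-outside)
    Y≥0 : NonNeg (act A w₀I Q)
    Y≥0 = longest-cone longestI Q≤0 (proj₂ ∘ PQ-outside)
    i′≗X+cY : e A i′ ≗ act A w₀I P ⊕ c ⊙ act A w₀I Q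
    i′≗X+cY k = begin
      e A i′ k                                 ≡⟨ act-act-reverse w₀I (e A i′) k ⟨
      act A w₀I y k                            ≡⟨ act-cong w₀I y≗P+cQ k ⟩
      act A w₀I (P ⊕ c ⊙ Q) k                  ≡⟨ act-⊕ w₀I P (c ⊙ Q) k ⟩
      act A w₀I P k + act A w₀I (c ⊙ Q) k      ≡⟨ cong (λ z → act A w₀I P k + z) (act-⊙ w₀I c Q k) ⟩
      act A w₀I P k + c * act A w₀I Q k        ∎
      where open ≡-Reasoning

  φ₀-cong : ∀ {x y} → x ≗ y → φ₀ x ≗ φ₀ y
  φ₀-cong x≗y = act-cong (reverse (zW A π I w₀ w₀I)) (λ k → x≗y (π ⟨$⟩ˡ k))

  module _ (α : Fin n) where

    φₛ : Lat A → Lat A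
    φₛ = φ A π I w₀ w₀I (α ∷ [])

    φₛ-injective : ∀ {x y} → φₛ x ≗ φₛ y → x ≗ y
    φₛ-injective φₛx≗φₛy = σL-injective (act-injective (α ∷ reverse (zW A π I w₀ w₀I)) φₛx≗φₛy)

    φ₀-via-φₛ : ∀ {i i′} → φₛ (e A i′) ≗ e A i → φ₀ (e A i′) ≗ e A i ⊕ (- A i α) ⊙ e A α
    φ₀-via-φₛ {i} {i′} φₛi′≗i k = begin
      φ₀ (e A i′) k                               ≡⟨ sref-involutive α (φ₀ (e A i′)) k ⟨
      sref A α (φₛ (e A i′)) k                    ≡⟨ sref-cong α φₛi′≗i k ⟩
      sref A α (e A i) k                          ≡⟨ sref-as-⊕ α (e A i) k ⟩
      e A i k + (- ⟨ e A i , α ∨⟩) * e A α k      ≡⟨ cong (λ a → e A i k + (- a) * e A α k) (pairing-e i α) ⟩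
      e A i k + (- A i α) * e A α k               ∎
      where open ≡-Reasoning

    φₛ⇒φ₀ : α ∉ I → ∀ {i i′} → i ∈ I → i′ ∈ I → φₛ (e A i′) ≗ e A i → φ₀ (e A i′) ≗ e A i
    φₛ⇒φ₀ α∉I {i} {i′} i∈I i′∈I φₛi′≗i with A i α ℤ.≟ 0ℤ
    ... | yes Aᵢα≡0 = λ k → trans (φ₀-via-φₛ φₛi′≗i k)
                              (trans (cong (λ a → e A i k + (- a) * e A α k) Aᵢα≡0) (ℤₚ.+-identityʳ (e A i k)))
    ... | no  Aᵢα≢0 = ⊥-elim (φ₀-not-sum i′∈I i α (ℤₚ.neg-mono-< (ℤₚ.≤∧≢⇒< Aᵢα≤0 Aᵢα≢0)) (φ₀-via-φₛ φₛi′≗i))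
      where
      Aᵢα≤0 : A i α ≤ 0ℤ
      Aᵢα≤0 = offdiag i α (λ i≡α → α∉I (subst (_∈ I) i≡α i∈I))

corollary5p4 : (n : ℕ) (A : Fin n → Fin n → ℤ) → IsFiniteCartan A →
               (π : Permutation′ n) → IsDiagramAut A π →
               (I : Subset n) (w₀ w₀I : Word A) →
               IsLongestIn A ⊤ w₀ → IsLongestIn A I w₀I →
               (α : Fin n) → α ∉ I →
               ∀ i → InIw A π I w₀ w₀I (α ∷ []) i → InIw A π I w₀ w₀I [] i
corollary5p4 n A cartan π aut I w₀ w₀I longest₀ longestI α α∉I =
  InAllImages-mono A I (φₛ α) φ₀ (φₛ-injective α) φ₀-cong (φₛ⇒φ₀ α α∉I)
  where open CanonicalParabolic A cartan π aut I w₀ w₀I longest₀ longestI
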